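{- Let $q$ be a prime power. For $i=1,2,3,4$ let $\mathcal F_i\subseteq[m_i]\times[n_i]$ be an $m_i\times n_i$ Ferrers diagram, where $m_4\geq m_1+m_2$ and $n_4\geq n_2+n_3$; put $m=m_3+m_4$, $n=n_1+n_4$. Suppose $\mathcal F\subseteq[m]\times[n]$ is an $m\times n$ Ferrers diagram that is the disjoint union $$\mathcal F=\mathcal F_1\ \cup\ (\mathcal F_2+(m_1,n_1))\ \cup\ (\mathcal F_4+(0,n_1))\ \cup\ (\mathcal F_3+(m_4,n-n_3)),$$ where $S+(a,b)=\{(i+a,j+b):(i,j)\in S\}$. Suppose $\mathcal F_{123}$ is a Ferrers diagram which is a proper combination of $\mathcal F_1$, $\mathcal F_2$ and $\mathcal F_3$, that there exists an $[\mathcal F_{123},k_1,\delta_1]_q$ code, and that there exists an $[\mathcal F_4,k_4,\delta_4]_q$ code. Then there exists an $[\mathcal F,k_1+k_4,\min\{\delta_1,\delta_4\}]_q$ code.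
   Context: $[a]$ denotes $\{0,1,\dots,a-1\}$. An $m\times n$ Ferrers diagram is a set $\mathcal F\subseteq[m]\times[n]$ of cells ("dots") such that: if $(i,j)\in\mathcal F$, $i\ge1$ then $(i-1,j)\in\mathcal F$; if $(i,j)\in\mathcal F$, $j\le n-2$ then $(i,j+1)\in\mathcal F$; row $0$ has $n$ dots and column $n-1$ has $m$ dots. An $[\mathcal F,k,\delta]_q$ code is a $k$-dimensional $\mathbb F_q$-linear subspace of $\mathbb F_q^{m\times n}$ all of whose matrices have zero entries outside $\mathcal F$ and whose nonzero matrices all have rank at least $\delta$. A Ferrers diagram $\mathcal G$ is a proper combination of Ferrers diagrams $\mathcal F_1,\dots,\mathcal F_s$ if there are injections $\phi_l:\mathcal F_l\to\mathcal G$ with pairwise disjoint images, $\sum_l|\mathcal F_l|=|\mathcal G|$, and such that for each $l$ and any two distinct cells of $\mathcal F_l$ lying in the same row or in the same column, their images under $\phi_l$ lie in the same row or in the same column of $\mathcal G$. -}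

module Defs where

open import Level using (0ℓ)
open import Algebra.Bundles using (CommutativeRing)
open import Data.Nat using (ℕ; zero; suc; _+_; _∸_; _^_; _≤_; _<_; _≤ᵇ_)
open import Data.Nat.Primality using (Prime)
open import Data.Fin using (Fin; toℕ)
import Data.Fin as Fin
open import Data.Bool using (Bool; true; false; if_then_else_; _∧_)
open import Data.Product using (Σ; ∃; _×_; _,_; proj₁; proj₂)
open import Data.Sum using (_⊎_)
open import Data.Vec using (Vec; lookup)
open import Data.List using (List; map; upTo)
open import Data.Nat.ListAction using (sum)
open import Relation.Nullary using (¬_)
open import Relation.Binary.PropositionalEquality using (_≡_)
import Relation.Binary.PropositionalEquality as ≡
open import Function.Bundles using (Inverse)

IsPrimePower : ℕ → Set
IsPrimePower q = ∃ λ p → ∃ λ e → Prime p × 1 ≤ e × q ≡ p ^ e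

record IsFiniteField (R : CommutativeRing 0ℓ 0ℓ) (q : ℕ) : Set where
  open CommutativeRing R renaming (_+_ to _+R_)
  field
    0≉1     : ¬ (0# ≈ 1#)
    inverse : ∀ x → ¬ (x ≈ 0#) → ∃ λ y → x * y ≈ 1#
    card    : Inverse setoid (≡.setoid (Fin q))

record Ferrers (m n : ℕ) : Set where
  field
    dot         : ℕ → ℕ → Bool
    inBounds    : ∀ i j → dot i j ≡ true → i < m × j < n
    upClosed    : ∀ i j → dot (suc i) j ≡ true → dot i j ≡ true
    rightClosed : ∀ i j → suc j < n → dot i j ≡ true → dot i (suc j) ≡ true
    row0        : 0 < m × (∀ j → j < n → dot 0 j ≡ true)
    lastCol     : 0 < n × (∀ i → i < m → dot i (n ∸ 1) ≡ true)

open Ferrers public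

AnyFerrers : Set
AnyFerrers = Σ ℕ λ m → Σ ℕ λ n → Ferrers m n

size : ∀ {m n} → Ferrers m n → ℕ
size {m} {n} F =
  sum (map (λ i → sum (map (λ j → if dot F i j then 1 else 0) (upTo n))) (upTo m))

Cell : ∀ {m n} → Ferrers m n → Set
Cell F = Σ (ℕ × ℕ) λ p → dot F (proj₁ p) (proj₂ p) ≡ true


SameLine : ℕ × ℕ → ℕ × ℕ → Set
SameLine (a , b) (c , d) = a ≡ c ⊎ b ≡ d

sumℕ : ∀ {s} → (Fin s → ℕ) → ℕ
sumℕ {zero}  f = 0
sumℕ {suc s} f = f Fin.zero + sumℕ (λ l → f (Fin.suc l))

record ProperCombination {m n s : ℕ} (G : Ferrers m n) (Fs : Vec AnyFerrers s) : Set where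
  field
    φ         : (l : Fin s) → Cell (proj₂ (proj₂ (lookup Fs l))) → Cell G
    injective : ∀ l c c' → proj₁ (φ l c) ≡ proj₁ (φ l c') → proj₁ c ≡ proj₁ c'
    disjoint  : ∀ l l' c c' → ¬ l ≡ l' → ¬ proj₁ (φ l c) ≡ proj₁ (φ l' c')
    count     : sumℕ (λ l → size (proj₂ (proj₂ (lookup Fs l)))) ≡ size G
    lines     : ∀ l c c' → ¬ proj₁ c ≡ proj₁ c' → SameLine (proj₁ c) (proj₁ c')
                → SameLine (proj₁ (φ l c)) (proj₁ (φ l c'))

shift : ℕ → ℕ → (ℕ → ℕ → Bool) → ℕ → ℕ → Bool
shift a b D i j = if (a ≤ᵇ i) ∧ (b ≤ᵇ j) then D (i ∸ a) (j ∸ b) else false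

DisjointUnion : ∀ {s} → (ℕ → ℕ → Bool) → Vec (ℕ → ℕ → Bool) s → Set
DisjointUnion D Ps = ∀ i j →
    (D i j ≡ true → ∃ λ l → lookup Ps l i j ≡ true)
  × (∀ l → lookup Ps l i j ≡ true → D i j ≡ true)
  × (∀ l l' → lookup Ps l i j ≡ true → lookup Ps l' i j ≡ true → l ≡ l')

module Codes (R : CommutativeRing 0ℓ 0ℓ) where
  open CommutativeRing R renaming (_+_ to _+R_)

  Matrix : ℕ → ℕ → Set
  Matrix m n = Fin m → Fin n → Carrier

  sumR : ∀ {k} → (Fin k → Carrier) → Carrier
  sumR {zero}  f = 0#
  sumR {suc k} f = f Fin.zero +R sumR (λ l → f (Fin.suc l))

  lincomb : ∀ {k m n} → (Fin k → Carrier) → (Fin k → Matrix m n) → Matrix m n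
  lincomb c B i j = sumR (λ l → c l * B l i j)

  IsZero : ∀ {m n} → Matrix m n → Set
  IsZero M = ∀ i j → M i j ≈ 0#

  RankAtLeast : ∀ {m n} → Matrix m n → ℕ → Set
  RankAtLeast {m} {n} M δ = ∃ λ (r : Fin δ → Fin m) →
    ∀ (c : Fin δ → Carrier) → (∀ j → sumR (λ l → c l * M (r l) j) ≈ 0#) → ∀ l → c l ≈ 0#

  -- An [F, k, δ] code: the R-span of k linearly independent matrices supported
  -- on F (hence a k-dimensional subspace), all of whose nonzero elements have rank ≥ δ.
  record Code {m n : ℕ} (F : Ferrers m n) (k δ : ℕ) : Set where
    field
      basis       : Fin k → Matrix m n
      independent : ∀ c → IsZero (lincomb c basis) → ∀ l → c l ≈ 0#
      supported   : ∀ l i j → dot F (toℕ i) (toℕ j) ≡ false → basis l i j ≈ 0#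
      minRank     : ∀ c → ¬ IsZero (lincomb c basis) → RankAtLeast (lincomb c basis) δ

module Submission where

-- A codeword of F is Φ Y + Ψ Z, with Y in the [F₁₂₃, k₁, δ₁] code and Z in the [F₄, k₄, δ₄] code:
-- Y is cut, along the injections of the proper combination, into pieces X₁, X₂, X₃ on F₁, F₂, F₃,
-- which Φ places at their translates in F, and Ψ places Z at the translate of F₄.
-- An injection that maps lines into lines acts on a piece as a relabelling of rows and columns,
-- possibly transposed, or collapses it into one line; as the pieces cover F₁₂₃ (by counting),
-- rank Y ≤ rank X₁ + rank X₂ + rank X₃. In F the pieces sit block lower triangularly (F₄ misses
-- the block of F₂ because the union is disjoint), so rank (Φ Y + Ψ Z) ≥ rank X₁ + rank X₂ + rank X₃
-- ≥ δ₁ when Y ≠ 0, while for Y = 0 the rank is that of Z, at least δ₄.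

open import Level using (0ℓ)
open import Algebra.Bundles using (CommutativeRing)
open import Data.Nat using (ℕ)
open import Data.Product using (Σ; _×_; _,_; proj₁; proj₂)
open import Relation.Nullary using (¬_)
open import Relation.Binary.PropositionalEquality using (_≡_)
open import Defs

module FinSums (R : CommutativeRing 0ℓ 0ℓ) where

  open import Data.Nat using (zero; suc; _+_)
  open import Data.Fin using (Fin; zero; suc; punchIn; _↑ˡ_; _↑ʳ_)
  open import Data.Fin.Properties using (punchInᵢ≢i)
  open import Data.Vec.Functional using (Vector; removeAt)
  import Relation.Binary.PropositionalEquality as ≡
  open ≡ using (_≡_; _≢_)

  open CommutativeRing R hiding (zero) renaming (_+_ to _+R_)
  open Codes R using (sumR)
  open import Algebra.Properties.Semiring.Sum semiring
    using (sum; sum-cong-≗; ∑-distrib-+; ∑-comm; sum-remove; *-distribˡ-sum)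
  open import Relation.Binary.Reasoning.Setoid setoid

  sumR≡sum : ∀ {k} (f : Vector Carrier k) → sumR f ≡ sum f
  sumR≡sum {zero}  f = ≡.refl
  sumR≡sum {suc k} f = ≡.cong (f zero +R_) (sumR≡sum (λ l → f (suc l)))

  sumR-cong : ∀ {k} {f g : Vector Carrier k} → (∀ l → f l ≈ g l) → sumR f ≈ sumR g
  sumR-cong {zero}  e = refl
  sumR-cong {suc k} e = +-cong (e zero) (sumR-cong (λ l → e (suc l)))

  sumR-zero : ∀ {k} {f : Vector Carrier k} → (∀ l → f l ≈ 0#) → sumR f ≈ 0#
  sumR-zero {zero}  e = refl
  sumR-zero {suc k} e = trans (+-cong (e zero) (sumR-zero (λ l → e (suc l)))) (+-identityˡ 0#)

  sumR-distrib-+ : ∀ {k} (f g : Vector Carrier k) → sumR (λ l → f l +R g l) ≈ sumR f +R sumR g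
  sumR-distrib-+ f g = begin
    sumR (λ l → f l +R g l)  ≡⟨ sumR≡sum (λ l → f l +R g l) ⟩
    sum (λ l → f l +R g l)   ≈⟨ ∑-distrib-+ f g ⟩
    sum f +R sum g           ≡⟨ ≡.cong₂ _+R_ (sumR≡sum f) (sumR≡sum g) ⟨
    sumR f +R sumR g         ∎

  *-distribˡ-sumR : ∀ {k} x (f : Vector Carrier k) → x * sumR f ≈ sumR (λ l → x * f l)
  *-distribˡ-sumR x f = begin
    x * sumR f               ≡⟨ ≡.cong (x *_) (sumR≡sum f) ⟩
    x * sum f                ≈⟨ *-distribˡ-sum x f ⟩
    sum (λ l → x * f l)      ≡⟨ sumR≡sum (λ l → x * f l) ⟨
    sumR (λ l → x * f l)     ∎

  *-distribʳ-sumR : ∀ {k} x (f : Vector Carrier k) → sumR f * x ≈ sumR (λ l → f l * x)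
  *-distribʳ-sumR {k} x f = trans (*-comm _ _) (trans (*-distribˡ-sumR x f) (sumR-cong (λ l → *-comm x (f l))))

  sumR-comm : ∀ {a b} (f : Fin a → Fin b → Carrier) →
              sumR (λ i → sumR (f i)) ≈ sumR (λ j → sumR (λ i → f i j))
  sumR-comm {a} {b} f = begin
    sumR (λ i → sumR (f i))           ≡⟨ sumR≡sum² f ⟩
    sum (λ i → sum (f i))             ≈⟨ ∑-comm f ⟩
    sum (λ j → sum (λ i → f i j))     ≡⟨ sumR≡sum² (λ j i → f i j) ⟨
    sumR (λ j → sumR (λ i → f i j))   ∎
    where
    sumR≡sum² : ∀ {c d} (g : Fin c → Fin d → Carrier) → sumR (λ i → sumR (g i)) ≡ sum (λ i → sum (g i))
    sumR≡sum² {c} g = ≡.trans (sumR≡sum (λ i → sumR (g i))) (sum-cong-≗ {c} (λ i → sumR≡sum (g i)))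

  sumR-remove : ∀ {k} (f : Vector Carrier (suc k)) i → sumR f ≈ f i +R sumR (removeAt f i)
  sumR-remove f i = begin
    sumR f                          ≡⟨ sumR≡sum f ⟩
    sum f                           ≈⟨ sum-remove f ⟩
    f i +R sum (removeAt f i)       ≡⟨ ≡.cong (f i +R_) (sumR≡sum (removeAt f i)) ⟨
    f i +R sumR (removeAt f i)      ∎

  sumR-single : ∀ {k} (f : Vector Carrier k) i → (∀ l → l ≢ i → f l ≈ 0#) → sumR f ≈ f i
  sumR-single {suc k} f i others = begin
    sumR f                       ≈⟨ sumR-remove f i ⟩
    f i +R sumR (removeAt f i)   ≈⟨ +-congˡ (sumR-zero (λ l → others (punchIn i l) (punchInᵢ≢i i l))) ⟩
    f i +R 0#                    ≈⟨ +-identityʳ _ ⟩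
    f i                          ∎

  sumR-split : ∀ {a b} (f : Vector Carrier (a + b)) →
               sumR f ≈ sumR (λ l → f (l ↑ˡ b)) +R sumR (λ l → f (a ↑ʳ l))
  sumR-split {zero}      f = sym (+-identityˡ _)
  sumR-split {suc a} {b} f = trans (+-congˡ (sumR-split {a} {b} (λ l → f (suc l)))) (sym (+-assoc _ _ _))

module RowSpaces {q : ℕ} (R : CommutativeRing 0ℓ 0ℓ) (𝔽 : IsFiniteField R q) where

  open import Data.Nat using (zero; suc; _+_; _≤_; z≤n; s≤s)
  open import Data.Nat.Properties using (m≤n⇒m≤1+n; m≤n⇒∃[o]m+o≡n; ≤-trans; +-mono-≤)
  open import Data.Fin using (Fin; zero; suc; punchIn; _↑ˡ_; _↑ʳ_; splitAt; join)
  open import Data.Fin.Properties using (any?; all?; ¬∀⟶∃¬; join-splitAt) renaming (_≟_ to _≟ᶠ_)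
  open import Data.Vec.Functional using (Vector; _∷_; _++_; head; tail; insertAt)
  open import Data.Vec.Functional.Properties using (lookup-++ˡ; lookup-++ʳ; insertAt-lookup; insertAt-punchIn)
  open import Data.Product using (∃; _×_; _,_; proj₁; proj₂)
  open import Data.Sum using (_⊎_; inj₁; inj₂)
  open import Data.Sum.Properties using ([,]-∘)
  open import Data.Empty using (⊥-elim)
  open import Relation.Nullary using (¬_; Dec; yes; no)
  open import Relation.Nullary.Decidable using (map′)
  open import Relation.Binary.Definitions using (Decidable)
  import Relation.Binary.PropositionalEquality as ≡
  open import Function.Bundles using (Inverse)

  open CommutativeRing R hiding (zero) renaming (_+_ to _+R_)
  open Codes R
  open IsFiniteField 𝔽
  open FinSums R
  open import Algebra.Properties.Group +-group using (inverseʳ-unique)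
  open import Algebra.Properties.Ring ring using (-‿distribˡ-*; -‿distribʳ-*)
  open import Algebra.Properties.CommutativeSemigroup *-commutativeSemigroup using (x∙yz≈y∙xz)
  open import Relation.Binary.Reasoning.Setoid setoid

  Row : ℕ → Set
  Row n = Vector Carrier n

  _≈?_ : Decidable _≈_
  x ≈? y with Inverse.to card x ≟ᶠ Inverse.to card y
  ... | yes e = yes (begin
    x                            ≈⟨ Inverse.strictlyInverseʳ card x ⟨
    Inverse.from card (Inverse.to card x) ≡⟨ ≡.cong (Inverse.from card) e ⟩
    Inverse.from card (Inverse.to card y) ≈⟨ Inverse.strictlyInverseʳ card y ⟩
    y                            ∎)
  ... | no ne = no λ e → ne (Inverse.to-cong card e)

  ∃?-Carrier : {P : Carrier → Set} → (∀ {x y} → x ≈ y → P x → P y) →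
               (∀ x → Dec (P x)) → Dec (∃ P)
  ∃?-Carrier resp P? = map′ (λ (i , p) → _ , p)
    (λ (x , p) → Inverse.to card x , resp (sym (Inverse.strictlyInverseʳ card x)) p)
    (any? (λ i → P? (Inverse.from card i)))

  ∃?-Vector : ∀ s {P : Vector Carrier s → Set} → (∀ {a b} → (∀ i → a i ≈ b i) → P a → P b) →
              (∀ a → Dec (P a)) → Dec (∃ P)
  ∃?-Vector zero    resp P? = map′ (λ p → _ , p) (λ (a , p) → resp (λ ()) p) (P? (λ ()))
  ∃?-Vector (suc s) resp P? = map′ (λ (x , a , p) → x ∷ a , p) (λ (a , p) → head a , tail a , resp η p)
    (∃?-Carrier (λ e (a , p) → a , resp (λ { zero → e ; (suc i) → refl }) p)
                (λ x → ∃?-Vector s (λ e → resp (λ { zero → refl ; (suc i) → e i })) (λ a → P? (x ∷ a))))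
    where
    η : ∀ {a : Vector Carrier (suc s)} i → a i ≈ (head a ∷ tail a) i
    η zero    = refl
    η (suc i) = refl

  linComb : ∀ {s n} → Vector Carrier s → (Fin s → Row n) → Row n
  linComb a w y = sumR (λ t → a t * w t y)

  InSpan : ∀ {s n} → (Fin s → Row n) → Row n → Set
  InSpan w v = ∃ λ a → ∀ y → v y ≈ linComb a w y

  Independent : ∀ {k n} → (Fin k → Row n) → Set
  Independent v = ∀ c → (∀ y → linComb c v y ≈ 0#) → ∀ t → c t ≈ 0#

  linComb-congˡ : ∀ {s n} {a b : Vector Carrier s} (w : Fin s → Row n) → (∀ t → a t ≈ b t) →
                  ∀ y → linComb a w y ≈ linComb b w y
  linComb-congˡ {s} w e y = sumR-cong {s} (λ t → *-congʳ (e t))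

  linComb-congʳ : ∀ {s n} (a : Vector Carrier s) {w w' : Fin s → Row n} → (∀ t y → w t y ≈ w' t y) →
                  ∀ y → linComb a w y ≈ linComb a w' y
  linComb-congʳ {s} a e y = sumR-cong {s} (λ t → *-congˡ (e t y))

  linComb-+* : ∀ {s n} (a b : Vector Carrier s) x (w : Fin s → Row n) y →
               linComb (λ t → a t +R x * b t) w y ≈ linComb a w y +R x * linComb b w y
  linComb-+* {s} a b x w y = begin
    sumR (λ t → (a t +R x * b t) * w t y)        ≈⟨ sumR-cong {s} (λ t → trans (distribʳ _ _ _) (+-congˡ (*-assoc _ _ _))) ⟩
    sumR (λ t → a t * w t y +R x * (b t * w t y)) ≈⟨ sumR-distrib-+ (λ t → a t * w t y) (λ t → x * (b t * w t y)) ⟩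
    linComb a w y +R sumR (λ t → x * (b t * w t y)) ≈⟨ +-congˡ (*-distribˡ-sumR x (λ t → b t * w t y)) ⟨
    linComb a w y +R x * linComb b w y           ∎

  linComb-zeroˡ : ∀ {s n} {a : Vector Carrier s} (w : Fin s → Row n) → (∀ t → a t ≈ 0#) → ∀ y → linComb a w y ≈ 0#
  linComb-zeroˡ {s} w z y = sumR-zero {s} (λ t → trans (*-congʳ (z t)) (zeroˡ _))

  linComb-zeroʳ : ∀ {s n} (a : Vector Carrier s) {w : Fin s → Row n} y → (∀ t → w t y ≈ 0#) → linComb a w y ≈ 0#
  linComb-zeroʳ {s} a y z = sumR-zero {s} (λ t → trans (*-congˡ (z t)) (zeroʳ _))

  linComb-* : ∀ {s n} x (a : Vector Carrier s) (w : Fin s → Row n) y →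
              linComb (λ t → x * a t) w y ≈ x * linComb a w y
  linComb-* {s} x a w y =
    trans (sumR-cong {s} (λ t → *-assoc x (a t) (w t y))) (sym (*-distribˡ-sumR x (λ t → a t * w t y)))

  linComb-++ : ∀ {s s' n} (a : Vector Carrier s) (a' : Vector Carrier s') (w : Fin s → Row n) (w' : Fin s' → Row n) y →
               linComb (a ++ a') (w ++ w') y ≈ linComb a w y +R linComb a' w' y
  linComb-++ {s} {s'} a a' w w' y = trans (sumR-split {s} {s'} _) (+-cong
    (sumR-cong (λ t → *-cong (reflexive (lookup-++ˡ a a' t)) (reflexive (≡.cong (λ r → r y) (lookup-++ˡ w w' t)))))
    (sumR-cong (λ t → *-cong (reflexive (lookup-++ʳ a a' t)) (reflexive (≡.cong (λ r → r y) (lookup-++ʳ w w' t))))))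

  Independent-resp : ∀ {k n} {v v' : Fin k → Row n} → (∀ t y → v t y ≈ v' t y) → Independent v → Independent v'
  Independent-resp e ind c H = ind c (λ y → trans (linComb-congʳ c e y) (H y))

  InSpan-resp : ∀ {s n} {w : Fin s → Row n} {v v'} → (∀ y → v y ≈ v' y) → InSpan w v → InSpan w v'
  InSpan-resp e (a , h) = a , λ y → trans (sym (e y)) (h y)

  InSpan-respˡ : ∀ {s n} {w w' : Fin s → Row n} {v} → (∀ t y → w t y ≈ w' t y) → InSpan w v → InSpan w' v
  InSpan-respˡ e (a , h) = a , λ y → trans (h y) (linComb-congʳ a e y)

  span-zero : ∀ {s n} {w : Fin s → Row n} {v} → (∀ y → v y ≈ 0#) → InSpan w v
  span-zero {w = w} z = (λ _ → 0#) , λ y → trans (z y) (sym (linComb-zeroˡ w (λ _ → refl) y))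

  span-+* : ∀ {s n} {w : Fin s → Row n} {u v} x → InSpan w u → InSpan w v → InSpan w (λ y → u y +R x * v y)
  span-+* {w = w} x (a , ha) (b , hb) = (λ t → a t +R x * b t) , λ y →
    trans (+-cong (ha y) (*-congˡ (hb y))) (sym (linComb-+* a b x w y))

  span-+ : ∀ {s n} {w : Fin s → Row n} {u v} → InSpan w u → InSpan w v → InSpan w (λ y → u y +R v y)
  span-+ su sv = InSpan-resp (λ y → +-congˡ (*-identityˡ _)) (span-+* 1# su sv)

  span-* : ∀ {s n} {w : Fin s → Row n} {v} x → InSpan w v → InSpan w (λ y → x * v y)
  span-* {w = w} x (a , h) = (λ t → x * a t) , λ y → trans (*-congˡ (h y)) (sym (linComb-* x a w y))

  span-sumR : ∀ {s n k} {w : Fin s → Row n} (V : Fin k → Row n) → (∀ i → InSpan w (V i)) →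
              InSpan w (λ y → sumR (λ i → V i y))
  span-sumR {k = zero}  V h = span-zero (λ _ → refl)
  span-sumR {k = suc k} V h = span-+ (h zero) (span-sumR (λ i → V (suc i)) (λ i → h (suc i)))

  span-++ˡ : ∀ {s s' n} {w : Fin s → Row n} (w' : Fin s' → Row n) {v} → InSpan w v → InSpan (w ++ w') v
  span-++ˡ {w = w} w' (a , h) = (a ++ λ _ → 0#) , λ y → begin
    _                                            ≈⟨ h y ⟩
    linComb a w y                                ≈⟨ +-identityʳ _ ⟨
    linComb a w y +R 0#                          ≈⟨ +-congˡ (linComb-zeroˡ w' (λ _ → refl) y) ⟨
    linComb a w y +R linComb (λ _ → 0#) w' y     ≈⟨ linComb-++ a _ w w' y ⟨
    linComb (a ++ λ _ → 0#) (w ++ w') y          ∎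

  span-++ʳ : ∀ {s s' n} (w : Fin s → Row n) {w' : Fin s' → Row n} {v} → InSpan w' v → InSpan (w ++ w') v
  span-++ʳ w {w'} (a , h) = ((λ _ → 0#) ++ a) , λ y → begin
    _                                            ≈⟨ h y ⟩
    linComb a w' y                               ≈⟨ +-identityˡ _ ⟨
    0# +R linComb a w' y                         ≈⟨ +-congʳ (linComb-zeroˡ w (λ _ → refl) y) ⟨
    linComb (λ _ → 0#) w y +R linComb a w' y     ≈⟨ linComb-++ _ a w w' y ⟨
    linComb ((λ _ → 0#) ++ a) (w ++ w') y        ∎

  span-map : ∀ {s n n'} (K : Fin n → Fin n' → Carrier) {w : Fin s → Row n} {v} → InSpan w v →
             InSpan (λ t y' → sumR (λ y → K y y' * w t y)) (λ y' → sumR (λ y → K y y' * v y))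
  span-map K {w} {v} (a , h) = a , λ y' → begin
    sumR (λ y → K y y' * v y)                       ≈⟨ sumR-cong (λ y → *-congˡ (h y)) ⟩
    sumR (λ y → K y y' * linComb a w y)             ≈⟨ sumR-cong (λ y → *-distribˡ-sumR (K y y') (λ t → a t * w t y)) ⟩
    sumR (λ y → sumR (λ t → K y y' * (a t * w t y))) ≈⟨ sumR-comm (λ y t → K y y' * (a t * w t y)) ⟩
    sumR (λ t → sumR (λ y → K y y' * (a t * w t y))) ≈⟨ sumR-cong (λ t → trans (sumR-cong (λ y → x∙yz≈y∙xz (K y y') (a t) (w t y))) (sym (*-distribˡ-sumR (a t) (λ y → K y y' * w t y)))) ⟩
    linComb a (λ t y' → sumR (λ y → K y y' * w t y)) y' ∎

  InSpan-empty : ∀ {s n} {w : Fin s → Row n} {v} → s ≡.≡ 0 → InSpan w v → ∀ y → v y ≈ 0#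
  InSpan-empty ≡.refl (a , h) = h

  span-head : ∀ {s n} (v : Row n) (u : Fin s → Row n) → InSpan (v ∷ u) v
  span-head {s} v u = (1# ∷ λ _ → 0#) , λ y → sym (begin
    1# * v y +R linComb (λ _ → 0#) u y ≈⟨ +-cong (*-identityˡ _) (linComb-zeroˡ u (λ _ → refl) y) ⟩
    v y +R 0#                          ≈⟨ +-identityʳ _ ⟩
    v y                                ∎)

  span-tail : ∀ {s n} (v : Row n) {u : Fin s → Row n} {x} → InSpan u x → InSpan (v ∷ u) x
  span-tail v (a , h) = (0# ∷ a) , λ y → trans (h y) (sym (trans (+-congʳ (zeroˡ _)) (+-identityˡ _)))

  Independent-∷ : ∀ {s n} {u : Fin s → Row n} {v : Row n} → Independent u → ¬ InSpan u v → Independent (v ∷ u)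
  Independent-∷ {u = u} {v} ind v∉u c H with c zero ≈? 0#
  ... | yes c₀≈0 = λ { zero → c₀≈0 ; (suc t) → ind (tail c) (λ y → trans (sym (rest≈ y)) (H y)) t }
    where
    rest≈ : ∀ y → c zero * v y +R linComb (tail c) u y ≈ linComb (tail c) u y
    rest≈ y = trans (+-congʳ (trans (*-congʳ c₀≈0) (zeroˡ _))) (+-identityˡ _)
  ... | no c₀≉0 = ⊥-elim (v∉u ((λ t → (- d) * c (suc t)) , λ y → begin
      v y                              ≈⟨ *-identityˡ _ ⟨
      1# * v y                         ≈⟨ *-congʳ (trans (sym (proj₂ (inverse _ c₀≉0))) (*-comm _ _)) ⟩
      (d * c zero) * v y               ≈⟨ *-assoc _ _ _ ⟩
      d * (c zero * v y)               ≈⟨ *-congˡ (inverseʳ-unique _ _ (trans (+-comm _ _) (H y))) ⟩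
      d * - linComb (tail c) u y       ≈⟨ -‿distribʳ-* _ _ ⟨
      - (d * linComb (tail c) u y)     ≈⟨ -‿distribˡ-* _ _ ⟩
      (- d) * linComb (tail c) u y     ≈⟨ linComb-* (- d) (tail c) u y ⟨
      linComb (λ t → (- d) * c (suc t)) u y ∎))
    where
    d : Carrier
    d = proj₁ (inverse (c zero) c₀≉0)

  record Basis {m n} (w : Fin m → Row n) : Set where
    field
      dim         : ℕ
      pick        : Fin dim → Fin m
      independent : Independent (λ t → w (pick t))
      spanning    : ∀ i → InSpan (λ t → w (pick t)) (w i)

  -- Decidable because the field is finite; this is what makes extracting a basis constructive.
  InSpan? : ∀ {s n} (w : Fin s → Row n) v → Dec (InSpan w v)
  InSpan? {s} w v = ∃?-Vector s (λ e h y → trans (h y) (linComb-congˡ w e y))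
                                 (λ a → all? (λ y → v y ≈? linComb a w y))

  basis : ∀ {m n} (w : Fin m → Row n) → Basis w
  basis {zero}  w = record { dim = 0 ; pick = λ () ; independent = λ _ _ () ; spanning = λ () }
  basis {suc m} w with basis (tail w)
  ... | B with InSpan? (λ t → w (suc (Basis.pick B t))) (w zero)
  ...   | yes w₀∈B = record
    { dim = Basis.dim B ; pick = λ t → suc (Basis.pick B t) ; independent = Basis.independent B
    ; spanning = λ { zero → w₀∈B ; (suc i) → Basis.spanning B i } }
  ...   | no w₀∉B = record
    { dim = suc (Basis.dim B) ; pick = zero ∷ (λ t → suc (Basis.pick B t))
    ; independent = Independent-resp same (Independent-∷ (Basis.independent B) w₀∉B)
    ; spanning = λ { zero → InSpan-respˡ same (span-head _ _)
                   ; (suc i) → InSpan-respˡ same (span-tail _ (Basis.spanning B i)) } }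
    where
    same : ∀ t y → (w zero ∷ (λ t → w (suc (Basis.pick B t)))) t y ≈ w ((zero ∷ (λ t → suc (Basis.pick B t))) t) y
    same zero    y = refl
    same (suc t) y = refl

  -- One elimination step: with v p as pivot on w zero, the other v i are reduced to vectors in the
  -- span of tail w, and stay independent.
  module PivotStep {k s n} (v : Fin (suc k) → Row n) (w : Fin (suc s) → Row n)
                   (a : Fin (suc k) → Vector Carrier (suc s)) (v≈ : ∀ i y → v i y ≈ linComb (a i) w y)
                   (p : Fin (suc k)) (aₚ≉0 : ¬ a p zero ≈ 0#) where

    μ : Fin k → Carrier
    μ t = - (a (punchIn p t) zero * proj₁ (inverse (a p zero) aₚ≉0))

    reduced : Fin k → Row n
    reduced t y = v (punchIn p t) y +R μ t * v p y

    μ-cancels : ∀ t → a (punchIn p t) zero +R μ t * a p zero ≈ 0#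
    μ-cancels t = begin
      α +R μ t * β            ≈⟨ +-congˡ (-‿distribˡ-* _ _) ⟨
      α +R - ((α * d) * β)    ≈⟨ +-congˡ (-‿cong (trans (*-assoc _ _ _) (trans (*-congˡ dβ≈1) (*-identityʳ _)))) ⟩
      α +R - α                ≈⟨ -‿inverseʳ α ⟩
      0#                      ∎
      where
      α = a (punchIn p t) zero
      β = a p zero
      d = proj₁ (inverse β aₚ≉0)
      dβ≈1 : d * β ≈ 1#
      dβ≈1 = trans (*-comm _ _) (proj₂ (inverse β aₚ≉0))

    reduced-inSpan : ∀ t → InSpan (tail w) (reduced t)
    reduced-inSpan t = tail c , λ y → begin
      reduced t y                                           ≈⟨ +-cong (v≈ _ y) (*-congˡ (v≈ p y)) ⟩
      linComb (a (punchIn p t)) w y +R μ t * linComb (a p) w y ≈⟨ linComb-+* (a (punchIn p t)) (a p) (μ t) w y ⟨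
      c zero * w zero y +R linComb (tail c) (tail w) y      ≈⟨ +-congʳ (trans (*-congʳ (μ-cancels t)) (zeroˡ _)) ⟩
      0# +R linComb (tail c) (tail w) y                     ≈⟨ +-identityˡ _ ⟩
      linComb (tail c) (tail w) y                           ∎
      where
      c : Vector Carrier (suc s)
      c u = a (punchIn p t) u +R μ t * a p u

    reduced-independent : Independent v → Independent reduced
    reduced-independent ind c H t = begin
      c t                   ≡⟨ insertAt-punchIn c p X t ⟨
      C (punchIn p t)       ≈⟨ ind C C-kills (punchIn p t) ⟩
      0#                    ∎
      where
      X = sumR (λ t → c t * μ t)
      C = insertAt c p X
      C-kills : ∀ y → linComb C v y ≈ 0#
      C-kills y = begin
        linComb C v y                                                   ≈⟨ sumR-remove (λ i → C i * v i y) p ⟩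
        C p * v p y +R sumR (λ t → C (punchIn p t) * v (punchIn p t) y)
          ≈⟨ +-cong (*-congʳ (reflexive (insertAt-lookup c p X)))
                    (sumR-cong {k} (λ t → *-congʳ (reflexive (insertAt-punchIn c p X t)))) ⟩
        X * v p y +R linComb c (λ t → v (punchIn p t)) y                ≈⟨ +-comm _ _ ⟩
        linComb c (λ t → v (punchIn p t)) y +R X * v p y
          ≈⟨ +-congˡ (trans (*-distribʳ-sumR (v p y) (λ t → c t * μ t)) (sumR-cong {k} (λ t → *-assoc _ _ _))) ⟩
        linComb c (λ t → v (punchIn p t)) y +R sumR (λ t → c t * (μ t * v p y))
          ≈⟨ sumR-distrib-+ (λ t → c t * v (punchIn p t) y) (λ t → c t * (μ t * v p y)) ⟨
        sumR (λ t → c t * v (punchIn p t) y +R c t * (μ t * v p y))  ≈⟨ sumR-cong {k} (λ t → distribˡ _ _ _) ⟨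
        linComb c reduced y                                             ≈⟨ H y ⟩
        0#                                                              ∎

  steinitz : ∀ s {k n} (v : Fin k → Row n) (w : Fin s → Row n) → Independent v → (∀ i → InSpan w (v i)) → k ≤ s
  steinitz _       {zero}  v w ind sp = z≤n
  steinitz zero    {suc k} v w ind sp = ⊥-elim (0≉1 (sym (ind (1# ∷ λ _ → 0#) v≈0 zero)))
    where
    v≈0 : ∀ y → linComb (1# ∷ λ _ → 0#) v y ≈ 0#
    v≈0 y = trans (+-cong (trans (*-identityˡ _) (proj₂ (sp zero) y)) (linComb-zeroˡ (tail v) (λ _ → refl) y))
                  (+-identityˡ 0#)
  steinitz (suc s) {suc k} v w ind sp with all? (λ i → proj₁ (sp i) zero ≈? 0#)
  ... | yes heads≈0 = m≤n⇒m≤1+n (steinitz s v (tail w) ind λ i →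
          tail (proj₁ (sp i)) , λ y → trans (proj₂ (sp i) y) (trans (+-congʳ (trans (*-congʳ (heads≈0 i)) (zeroˡ _))) (+-identityˡ _)))
  ... | no ¬heads≈0 = s≤s (steinitz s reduced (tail w) (reduced-independent ind) reduced-inSpan)
    where
    pivot = ¬∀⟶∃¬ (suc k) _ (λ i → proj₁ (sp i) zero ≈? 0#) ¬heads≈0
    open PivotStep v w (λ i → proj₁ (sp i)) (λ i → proj₂ (sp i)) (proj₁ pivot) (proj₂ pivot)

  ∀-↑ : ∀ {a b} {P : Fin (a + b) → Set} → (∀ t → P (t ↑ˡ b)) → (∀ t → P (a ↑ʳ t)) → ∀ i → P i
  ∀-↑ {a} {b} {P} top bottom i = ≡.subst P (join-splitAt a b i) (cases (splitAt a i))
    where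
    cases : (s : Fin a ⊎ Fin b) → P (join a b s)
    cases (inj₁ t) = top t
    cases (inj₂ t) = bottom t

  linComb-split : ∀ {a b n} (c : Vector Carrier (a + b)) (v : Fin (a + b) → Row n) y →
                  linComb c v y ≈ linComb (λ t → c (t ↑ˡ b)) (λ t → v (t ↑ˡ b)) y
                                    +R linComb (λ t → c (a ↑ʳ t)) (λ t → v (a ↑ʳ t)) y
  linComb-split {a} {b} c v y = sumR-split {a} {b} (λ i → c i * v i y)

  Independent-fromColumns : ∀ {k n n'} (κ : Fin n' → Fin n) {v : Fin k → Row n} →
                            Independent (λ t j → v t (κ j)) → Independent v
  Independent-fromColumns κ ind c H = ind c (λ j → H (κ j))

  Independent-++ : ∀ {r r' n n'} (κ : Fin n' → Fin n) {u : Fin r → Row n} {v : Fin r' → Row n} →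
                   Independent (λ t j → u t (κ j)) → (∀ t j → v t (κ j) ≈ 0#) → Independent v →
                   Independent (u ++ v)
  Independent-++ {r} {r'} κ {u} {v} u-ind v≈0 v-ind c H = ∀-↑ {r} {r'} {λ i → c i ≈ 0#} cᵤ≈0 cᵥ≈0
    where
    cᵤ cᵥ : _
    cᵤ t = c (t ↑ˡ r')
    cᵥ t = c (r ↑ʳ t)
    H-split : ∀ y → linComb cᵤ u y +R linComb cᵥ v y ≈ 0#
    H-split y = trans (sym (+-cong
      (linComb-congʳ cᵤ (λ t y → reflexive (≡.cong (λ w → w y) (lookup-++ˡ u v t))) y)
      (linComb-congʳ cᵥ (λ t y → reflexive (≡.cong (λ w → w y) (lookup-++ʳ u v t))) y)))
      (trans (sym (linComb-split {r} {r'} c (u ++ v) y)) (H y))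
    cᵤ≈0 : ∀ t → cᵤ t ≈ 0#
    cᵤ≈0 = u-ind cᵤ λ j → trans (sym (+-identityʳ _))
             (trans (+-congˡ (sym (linComb-zeroʳ cᵥ {v} (κ j) (λ t → v≈0 t j)))) (H-split (κ j)))
    cᵥ≈0 : ∀ t → cᵥ t ≈ 0#
    cᵥ≈0 = v-ind cᵥ λ y → trans (sym (+-identityˡ _))
             (trans (+-congʳ (sym (linComb-zeroˡ u cᵤ≈0 y))) (H-split y))

  Independent-↑ˡ : ∀ {a b n} (v : Fin (a + b) → Row n) → Independent v → Independent (λ t → v (t ↑ˡ b))
  Independent-↑ˡ {a} {b} v ind c H t = begin
    c t              ≡⟨ lookup-++ˡ c (λ _ → 0#) t ⟨
    C (t ↑ˡ b)       ≈⟨ ind C C-kills (t ↑ˡ b) ⟩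
    0#               ∎
    where
    C = c ++ λ _ → 0#
    C-kills : ∀ y → linComb C v y ≈ 0#
    C-kills y = begin
      linComb C v y                                        ≈⟨ linComb-split {a} {b} C v y ⟩
      linComb (λ t → C (t ↑ˡ b)) (λ t → v (t ↑ˡ b)) y
        +R linComb (λ t → C (a ↑ʳ t)) (λ t → v (a ↑ʳ t)) y
        ≈⟨ +-cong (linComb-congˡ (λ t → v (t ↑ˡ b)) (λ t → reflexive (lookup-++ˡ c _ t)) y)
                  (linComb-zeroˡ (λ t → v (a ↑ʳ t)) (λ t → reflexive (lookup-++ʳ c _ t)) y) ⟩
      linComb c (λ t → v (t ↑ˡ b)) y +R 0#                 ≈⟨ +-identityʳ _ ⟩
      linComb c (λ t → v (t ↑ˡ b)) y                       ≈⟨ H y ⟩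
      0#                                                   ∎

  RankAtLeast-≤ : ∀ {m n d d'} (M : Matrix m n) → d' ≤ d → RankAtLeast M d → RankAtLeast M d'
  RankAtLeast-≤ {d' = d'} M d'≤d with m≤n⇒∃[o]m+o≡n d'≤d
  ... | e , ≡.refl = λ (r , ind) → (λ t → r (t ↑ˡ e)) , Independent-↑ˡ (λ t → M (r t)) ind

  RankAtLeast-resp : ∀ {m n d} {M M' : Matrix m n} → (∀ i j → M i j ≈ M' i j) → RankAtLeast M d → RankAtLeast M' d
  RankAtLeast-resp e (r , ind) = r , Independent-resp (λ t → e (r t)) ind

  columns-inSpan : ∀ {m n} (X : Fin m → Row n) (B : Basis X) j →
                   InSpan (λ t i → proj₁ (Basis.spanning B i) t) (λ i → X i j)
  columns-inSpan X B j = (λ t → X (Basis.pick B t) j) , λ i →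
    trans (proj₂ (Basis.spanning B i) j) (sumR-cong {Basis.dim B} (λ t → *-comm _ _))

  RankAtMost : ∀ {m n} → Matrix m n → ℕ → Set
  RankAtMost {m} {n} M r = ∃ λ s → s ≤ r × ∃ λ (U : Fin s → Row n) → ∀ g → InSpan U (M g)

  RankAtLeast⇒≤RankAtMost : ∀ {m n d r} {M : Matrix m n} → RankAtLeast M d → RankAtMost M r → d ≤ r
  RankAtLeast⇒≤RankAtMost {M = M} (pick , ind) (s , s≤r , U , spans) =
    ≤-trans (steinitz s (λ t → M (pick t)) U ind (λ t → spans (pick t))) s≤r

  RankAtMost-resp : ∀ {m n r} {M M' : Matrix m n} → (∀ g y → M g y ≈ M' g y) → RankAtMost M r → RankAtMost M' r
  RankAtMost-resp e (s , s≤r , U , spans) = s , s≤r , U , λ g → InSpan-resp (e g) (spans g)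

  concatRows : ∀ {k n} {len : Fin k → ℕ} → (∀ l → Fin (len l) → Row n) → Fin (sumℕ len) → Row n
  concatRows {zero}  U = λ ()
  concatRows {suc k} U = U zero ++ concatRows (λ l → U (suc l))

  span-concatRows : ∀ {k n} {len : Fin k → ℕ} (U : ∀ l → Fin (len l) → Row n) l {v} →
                    InSpan (U l) v → InSpan (concatRows U) v
  span-concatRows {suc k} U zero    v∈ = span-++ˡ (concatRows (λ l → U (suc l))) v∈
  span-concatRows {suc k} U (suc l) v∈ = span-++ʳ (U zero) (span-concatRows (λ l → U (suc l)) l v∈)

  sumℕ-mono-≤ : ∀ {k} {f g : Fin k → ℕ} → (∀ l → f l ≤ g l) → sumℕ f ≤ sumℕ g
  sumℕ-mono-≤ {zero}  le = z≤n
  sumℕ-mono-≤ {suc k} le = +-mono-≤ (le zero) (sumℕ-mono-≤ (λ l → le (suc l)))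

  RankAtMost-sumR : ∀ {k m n} (E : Fin k → Matrix m n) (r : Fin k → ℕ) → (∀ l → RankAtMost (E l) (r l)) →
                    RankAtMost (λ g y → sumR (λ l → E l g y)) (sumℕ r)
  RankAtMost-sumR E r bound = sumℕ (λ l → proj₁ (bound l)) , sumℕ-mono-≤ (λ l → proj₁ (proj₂ (bound l))) ,
    concatRows (λ l → proj₁ (proj₂ (proj₂ (bound l)))) , λ g →
    span-sumR (λ l y → E l g y) (λ l → span-concatRows _ l (proj₂ (proj₂ (proj₂ (bound l))) g))

  RankAtMost-outer : ∀ {m n} (E : Matrix m n) (u : Row m) (w : Row n) r →
                     (∀ g y → E g y ≈ u g * w y) → (r ≡.≡ 0 → ∀ g y → E g y ≈ 0#) → RankAtMost E r
  RankAtMost-outer E u w zero    E≈uw r≡0 = 0 , z≤n , (λ ()) , λ g → span-zero {w = λ ()} (r≡0 ≡.refl g)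
  RankAtMost-outer E u w (suc r) E≈uw _   = 1 , s≤s z≤n , (λ _ → w) , λ g →
    (λ _ → u g) , λ y → trans (E≈uw g y) (sym (+-identityʳ _))

  IsZero? : ∀ {m n} (M : Matrix m n) → Dec (IsZero M)
  IsZero? M = all? (λ i → all? (λ j → M i j ≈? 0#))

  ∀-++ : ∀ {a b} {A : Set} {P : A → Set} (u : Fin a → A) (v : Fin b → A) →
         (∀ t → P (u t)) → (∀ t → P (v t)) → ∀ t → P ((u ++ v) t)
  ∀-++ {a} u v Pu Pv t with splitAt a t
  ... | inj₁ t' = Pu t'
  ... | inj₂ t' = Pv t'

  Independent-rows-++ : ∀ {m n n' r r'} (M : Matrix m n) (κ : Fin n' → Fin n) (u : Fin r → Fin m) (v : Fin r' → Fin m) →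
                        Independent (λ t j → M (u t) (κ j)) → (∀ t j → M (v t) (κ j) ≈ 0#) →
                        Independent (λ t → M (v t)) → Independent (λ t → M ((u ++ v) t))
  Independent-rows-++ {r = r} M κ u v u-ind v≈0 v-ind = Independent-resp
    (λ t y → reflexive (≡.cong (λ row → row y) (≡.sym ([,]-∘ M (splitAt r t)))))
    (Independent-++ κ u-ind v≈0 v-ind)

module LinePreservingMaps where

  open import Data.Nat using (ℕ; _<_; _∸_; _≟_; s≤s)
  open import Data.Nat.Properties using (n<1+n; anyUpTo?)
  open import Data.Bool using (true)
  open import Data.Product using (_×_; _,_; proj₁; proj₂; swap)
  open import Data.Product.Properties using (×-≡,≡→≡)
  open import Data.Sum using (_⊎_; inj₁; inj₂)
  open import Data.Empty using (⊥-elim)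
  open import Relation.Nullary using (yes; no; ¬?)
  open import Relation.Nullary.Decidable using (decidable-stable)
  open import Relation.Binary.PropositionalEquality using (_≡_; _≢_; refl; sym; trans; cong)

  SameLine-swap : ∀ p p' → SameLine p p' → SameLine (swap p) (swap p')
  SameLine-swap _ _ (inj₁ e) = inj₂ e
  SameLine-swap _ _ (inj₂ e) = inj₁ e

  collinear : ∀ n (p : ℕ → ℕ × ℕ) o → o < n →
              (∀ j j' → j < n → j' < n → j ≢ j' → SameLine (p j) (p j')) →
              (∀ j → j < n → proj₁ (p j) ≡ proj₁ (p o)) ⊎ (∀ j → j < n → proj₂ (p j) ≡ proj₂ (p o))
  collinear n p o o<n lines with anyUpTo? (λ j → ¬? (proj₁ (p j) ≟ proj₁ (p o))) n
  ... | no noneOff = inj₁ λ j j<n →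
          decidable-stable (proj₁ (p j) ≟ proj₁ (p o)) (λ off → noneOff (j , j<n , off))
  ... | yes (j₁ , j₁<n , j₁-off) = inj₂ sameColumn
    where
    column-j₁ : proj₂ (p j₁) ≡ proj₂ (p o)
    column-j₁ with lines j₁ o j₁<n o<n (λ { refl → j₁-off refl })
    ... | inj₁ e = ⊥-elim (j₁-off e)
    ... | inj₂ e = e
    sameColumn : ∀ j → j < n → proj₂ (p j) ≡ proj₂ (p o)
    sameColumn j j<n with j ≟ o
    ... | yes refl = refl
    ... | no j≢o with lines j o j<n o<n j≢o
    ...   | inj₂ e = e
    ...   | inj₁ e with j ≟ j₁
    ...     | yes refl = ⊥-elim (j₁-off e)
    ...     | no j≢j₁ with lines j j₁ j<n j₁<n j≢j₁
    ...       | inj₁ e' = ⊥-elim (j₁-off (trans (sym e') e))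
    ...       | inj₂ e' = trans e' column-j₁

  record LinePreserving {a b} (F : Ferrers a b) (f : ℕ → ℕ → ℕ × ℕ) : Set where
    field
      rowLines  : ∀ x y y' → dot F x y ≡ true → dot F x y' ≡ true → y ≢ y' → SameLine (f x y) (f x y')
      colLines  : ∀ x x' y → dot F x y ≡ true → dot F x' y ≡ true → x ≢ x' → SameLine (f x y) (f x' y)
      injective : ∀ x y x' y' → dot F x y ≡ true → dot F x' y' ≡ true → f x y ≡ f x' y' → x ≡ x' × y ≡ y'

    transpose : LinePreserving F (λ x y → swap (f x y))
    transpose = record
      { rowLines  = λ x y y' d d' ne → SameLine-swap _ _ (rowLines x y y' d d' ne)
      ; colLines  = λ x x' y d d' ne → SameLine-swap _ _ (colLines x x' y d d' ne)
      ; injective = λ x y x' y' d d' e → injective x y x' y' d d' (cong swap e)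
      }

  data Shape {a b} (F : Ferrers a b) (f : ℕ → ℕ → ℕ × ℕ) : Set where
    product     : (ρ κ : ℕ → ℕ) → (∀ x y → dot F x y ≡ true → f x y ≡ (ρ x , κ y)) → Shape F f
    transposed  : (ρ κ : ℕ → ℕ) → (∀ x y → dot F x y ≡ true → f x y ≡ (ρ y , κ x)) → Shape F f
    inOneRow    : (r : ℕ) → (∀ x y → dot F x y ≡ true → proj₁ (f x y) ≡ r) → Shape F f
    inOneColumn : (c : ℕ) → (∀ x y → dot F x y ≡ true → proj₂ (f x y) ≡ c) → Shape F f

  -- Row 0 and the last column are full and meet in the corner (0 , b ∸ 1); each is mapped into a
  -- line through the image of the corner, and the way these two lines lie determines the shape.
  module Corner {a b} (F : Ferrers a b) {f : ℕ → ℕ → ℕ × ℕ} (L : LinePreserving F f) where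
    open LinePreserving L

    last<b : b ∸ 1 < b
    last<b with proj₁ (lastCol F)
    ... | s≤s _ = n<1+n _

    firstRowDots : ∀ y → y < b → dot F 0 y ≡ true
    firstRowDots = proj₂ (row0 F)

    lastColumnDots : ∀ x → x < a → dot F x (b ∸ 1) ≡ true
    lastColumnDots = proj₂ (lastCol F)

    corner : ℕ × ℕ
    corner = f 0 (b ∸ 1)

    RowFlat RowUpright ColumnFlat ColumnUpright : Set
    RowFlat       = ∀ y → y < b → proj₁ (f 0 y) ≡ proj₁ corner
    RowUpright    = ∀ y → y < b → proj₂ (f 0 y) ≡ proj₂ corner
    ColumnFlat    = ∀ x → x < a → proj₁ (f x (b ∸ 1)) ≡ proj₁ corner
    ColumnUpright = ∀ x → x < a → proj₂ (f x (b ∸ 1)) ≡ proj₂ corner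

    firstRowLine : RowFlat ⊎ RowUpright
    firstRowLine = collinear b (f 0) (b ∸ 1) last<b
                 (λ j j' j<b j'<b ne → rowLines 0 j j' (firstRowDots j j<b) (firstRowDots j' j'<b) ne)

    lastColumnLine : ColumnFlat ⊎ ColumnUpright
    lastColumnLine = collinear a (λ x → f x (b ∸ 1)) 0 (proj₁ (row0 F))
                 (λ j j' j<a j'<a ne → colLines j j' (b ∸ 1) (lastColumnDots j j<a) (lastColumnDots j' j'<a) ne)

    flat-flat : RowFlat → ColumnFlat → ∀ x y → dot F x y ≡ true → proj₁ (f x y) ≡ proj₁ corner
    flat-flat rf cf x y d with inBounds F x y d
    ... | x<a , y<b with x ≟ 0 | y ≟ b ∸ 1
    ...   | yes refl | _        = rf y y<b
    ...   | no _     | yes refl = cf x x<a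
    ...   | no x≢0   | no y≢last with colLines x 0 y d (firstRowDots y y<b) x≢0 | rowLines x y (b ∸ 1) d (lastColumnDots x x<a) y≢last
    ...     | inj₁ e₁ | _       = trans e₁ (rf y y<b)
    ...     | inj₂ _  | inj₁ e₂ = trans e₂ (cf x x<a)
    ...     | inj₂ e₁ | inj₂ e₂ = ⊥-elim (x≢0 (sym (proj₁ (injective 0 y x (b ∸ 1) (firstRowDots y y<b) (lastColumnDots x x<a)
                                    (×-≡,≡→≡ (trans (rf y y<b) (sym (cf x x<a)) , trans (sym e₁) e₂))))))

    flat-upright : RowFlat → ColumnUpright → ∀ x y → dot F x y ≡ true → f x y ≡ (proj₁ (f x (b ∸ 1)) , proj₂ (f 0 y))
    flat-upright rf cu x y d with inBounds F x y d
    ... | x<a , y<b with x ≟ 0 | y ≟ b ∸ 1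
    ...   | yes refl | _        = ×-≡,≡→≡ (rf y y<b , refl)
    ...   | no _     | yes refl = ×-≡,≡→≡ (refl , cu x x<a)
    ...   | no x≢0   | no y≢last with colLines x 0 y d (firstRowDots y y<b) x≢0 | rowLines x y (b ∸ 1) d (lastColumnDots x x<a) y≢last
    ...     | inj₂ e₁ | inj₁ e₂ = ×-≡,≡→≡ (e₂ , e₁)
    ...     | inj₁ e₁ | inj₁ e₂ = ⊥-elim (x≢0 (proj₁ (injective x (b ∸ 1) 0 (b ∸ 1) (lastColumnDots x x<a) (firstRowDots (b ∸ 1) last<b)
                                    (×-≡,≡→≡ (trans (sym e₂) (trans e₁ (rf y y<b)) , cu x x<a)))))
    ...     | inj₁ e₁ | inj₂ e₂ = ⊥-elim (y≢last (proj₂ (injective x y 0 (b ∸ 1) d (firstRowDots (b ∸ 1) last<b)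
                                    (×-≡,≡→≡ (trans e₁ (rf y y<b) , trans e₂ (cu x x<a))))))
    ...     | inj₂ e₁ | inj₂ e₂ = ⊥-elim (y≢last (proj₂ (injective 0 y 0 (b ∸ 1) (firstRowDots y y<b) (firstRowDots (b ∸ 1) last<b)
                                    (×-≡,≡→≡ (rf y y<b , trans (sym e₁) (trans e₂ (cu x x<a)))))))

  shape : ∀ {a b} (F : Ferrers a b) {f : ℕ → ℕ → ℕ × ℕ} → LinePreserving F f → Shape F f
  shape F L with Corner.firstRowLine F L | Corner.lastColumnLine F L
  ... | inj₁ rf | inj₁ cf = inOneRow _ (Corner.flat-flat F L rf cf)
  ... | inj₁ rf | inj₂ cu = product _ _ (Corner.flat-upright F L rf cu)
  ... | inj₂ ru | inj₂ cu = inOneColumn _ (Corner.flat-flat F (LinePreserving.transpose L) ru cu)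
  ... | inj₂ ru | inj₁ cf = transposed _ _ λ x y d → cong swap (Corner.flat-upright F (LinePreserving.transpose L) ru cf x y d)

module Counting where

  open import Data.Nat using (ℕ; suc; _+_; _≤_; _<_; z≤n; s≤s)
  open import Data.Nat.Properties using (≤-trans; <-≤-trans; ≤-<-trans; <-irrefl)
  open import Data.Nat.ListAction using (sum)
  open import Data.Bool using (Bool; true; false; if_then_else_)
  open import Data.Fin using (Fin; zero; suc)
  open import Data.Fin.Properties using (suc-injective)
  open import Data.Product using (∃; _×_; _,_; proj₁; proj₂)
  open import Data.Sum using (inj₁; inj₂)
  open import Data.Empty using (⊥-elim)
  open import Data.List using (List; []; _∷_; _++_; length; map; filter; upTo)
  open import Data.List.Properties using (length-++; filter-notAll)
  open import Data.List.Relation.Unary.Any using (here; there)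
  import Data.List.Relation.Unary.Any as Any
  open import Data.List.Relation.Unary.All using (All; []; _∷_)
  open import Data.List.Relation.Unary.AllPairs using ([]; _∷_)
  import Data.List.Relation.Unary.All as All
  open import Data.List.Relation.Unary.Unique.Propositional using (Unique)
  open import Data.List.Relation.Unary.Unique.Propositional.Properties using (++⁺; upTo⁺)
  open import Data.List.Relation.Binary.Disjoint.Propositional using (Disjoint)
  open import Data.List.Relation.Binary.Subset.Propositional using (_⊆_)
  open import Data.List.Membership.Propositional using (_∈_)
  open import Data.List.Membership.Propositional.Properties using (∈-filter⁺; ∈-++⁺ˡ; ∈-++⁺ʳ; ∈-++⁻; ∈-upTo⁺)
  import Data.List.Membership.DecPropositional as DecMembership
  open import Relation.Nullary using (yes; no; ¬?)
  open import Relation.Binary.Definitions using (DecidableEquality)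
  open import Relation.Binary.PropositionalEquality using (_≡_; _≢_; refl; sym; trans; cong; cong₂; subst)

  module _ {A : Set} (_≟_ : DecidableEquality A) where

    private
      without : A → List A → List A
      without x = filter (λ z → ¬? (x ≟ z))

      length-without : ∀ {x} zs → x ∈ zs → length (without x zs) < length zs
      length-without zs x∈zs = filter-notAll _ zs (Any.map (λ e ne → ne e) x∈zs)

    Unique-⊆⇒length-≤ : ∀ {xs zs : List A} → Unique xs → xs ⊆ zs → length xs ≤ length zs
    Unique-⊆⇒length-≤ {[]}     _           _   = z≤n
    Unique-⊆⇒length-≤ {x ∷ xs} (x∉xs ∷ u) sub = ≤-trans
      (s≤s (Unique-⊆⇒length-≤ u (λ y∈ → ∈-filter⁺ _ (sub (there y∈)) (All.lookup x∉xs y∈))))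
      (length-without _ (sub (here refl)))

    Unique-⊆-length⇒⊇ : ∀ {xs zs : List A} → Unique xs → xs ⊆ zs → length zs ≤ length xs → zs ⊆ xs
    Unique-⊆-length⇒⊇ {xs} {zs} u sub len {z} z∈zs with DecMembership._∈?_ _≟_ z xs
    ... | yes z∈xs = z∈xs
    ... | no z∉xs = ⊥-elim (<-irrefl refl (<-≤-trans (≤-<-trans
            (Unique-⊆⇒length-≤ u (λ x∈ → ∈-filter⁺ _ (sub x∈) (λ { refl → z∉xs x∈ })))
            (length-without zs z∈zs)) len))

  Unique-map⁺ : ∀ {A B : Set} (f : A → B) {xs : List A} →
                (∀ {x x'} → x ∈ xs → x' ∈ xs → f x ≡ f x' → x ≡ x') → Unique xs → Unique (map f xs)
  Unique-map⁺ f {[]}     inj []          = []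
  Unique-map⁺ f {x ∷ xs} inj (x∉xs ∷ u) =
    distinct xs x∉xs (λ w∈ → there w∈) ∷ Unique-map⁺ f (λ a b → inj (there a) (there b)) u
    where
    distinct : ∀ ws → All (x ≢_) ws → ws ⊆ x ∷ xs → All (f x ≢_) (map f ws)
    distinct []       []          _   = []
    distinct (w ∷ ws) (x≢w ∷ x∉) sub =
      (λ e → x≢w (inj (here refl) (sub (here refl)) e)) ∷ distinct ws x∉ (λ m → sub (there m))

  concatFin : ∀ {A : Set} {s} → (Fin s → List A) → List A
  concatFin {s = 0}     f = []
  concatFin {s = suc s} f = f zero ++ concatFin (λ l → f (suc l))

  module _ {A : Set} where

    ∈-concatFin⁻ : ∀ {s} (f : Fin s → List A) {z} → z ∈ concatFin f → ∃ λ l → z ∈ f l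
    ∈-concatFin⁻ {suc s} f z∈ with ∈-++⁻ (f zero) z∈
    ... | inj₁ z∈₀ = zero , z∈₀
    ... | inj₂ z∈ₛ with ∈-concatFin⁻ (λ l → f (suc l)) z∈ₛ
    ...   | l , z∈ₗ = suc l , z∈ₗ

    length-concatFin : ∀ {s} (f : Fin s → List A) → length (concatFin f) ≡ sumℕ (λ l → length (f l))
    length-concatFin {0}     f = refl
    length-concatFin {suc s} f = trans (length-++ (f zero)) (cong (length (f zero) +_) (length-concatFin (λ l → f (suc l))))

    Unique-concatFin : ∀ {s} (f : Fin s → List A) → (∀ l → Unique (f l)) →
                       (∀ l l' → l ≢ l' → Disjoint (f l) (f l')) → Unique (concatFin f)
    Unique-concatFin {0}     f _ _ = []
    Unique-concatFin {suc s} f u d = ++⁺ (u zero) (Unique-concatFin (λ l → f (suc l)) (λ l → u (suc l)) (λ l l' ne → d (suc l) (suc l') (λ e → ne (suc-injective e))))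
      λ (z∈₀ , z∈ₛ) → let l , z∈ₗ = ∈-concatFin⁻ (λ l → f (suc l)) z∈ₛ in d zero (suc l) (λ ()) (z∈₀ , z∈ₗ)

  rowDots : (ℕ → ℕ → Bool) → ℕ → List ℕ → List (ℕ × ℕ)
  rowDots D x []       = []
  rowDots D x (y ∷ ys) = if D x y then (x , y) ∷ rowDots D x ys else rowDots D x ys

  dots : (ℕ → ℕ → Bool) → List ℕ → List ℕ → List (ℕ × ℕ)
  dots D []       ys = []
  dots D (x ∷ xs) ys = rowDots D x ys ++ dots D xs ys

  length-rowDots : ∀ D x ys → length (rowDots D x ys) ≡ sum (map (λ j → if D x j then 1 else 0) ys)
  length-rowDots D x []       = refl
  length-rowDots D x (y ∷ ys) with D x y
  ... | true  = cong suc (length-rowDots D x ys)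
  ... | false = length-rowDots D x ys

  length-dots : ∀ D xs ys → length (dots D xs ys) ≡ sum (map (λ i → sum (map (λ j → if D i j then 1 else 0) ys)) xs)
  length-dots D []       ys = refl
  length-dots D (x ∷ xs) ys = trans (length-++ (rowDots D x ys)) (cong₂ _+_ (length-rowDots D x ys) (length-dots D xs ys))

  ∈-rowDots⁺ : ∀ D x {y} ys → y ∈ ys → D x y ≡ true → (x , y) ∈ rowDots D x ys
  ∈-rowDots⁺ D x (y ∷ ys) (here refl) d rewrite d = here refl
  ∈-rowDots⁺ D x (y' ∷ ys) (there y∈) d with D x y'
  ... | true  = there (∈-rowDots⁺ D x ys y∈ d)
  ... | false = ∈-rowDots⁺ D x ys y∈ d

  ∈-rowDots⁻ : ∀ D x ys {p} → p ∈ rowDots D x ys → proj₁ p ≡ x × D (proj₁ p) (proj₂ p) ≡ true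
  ∈-rowDots⁻ D x (y ∷ ys) p∈ with D x y in d
  ∈-rowDots⁻ D x (y ∷ ys) (here refl) | true = refl , d
  ∈-rowDots⁻ D x (y ∷ ys) (there p∈)  | true = ∈-rowDots⁻ D x ys p∈
  ∈-rowDots⁻ D x (y ∷ ys) p∈          | false = ∈-rowDots⁻ D x ys p∈

  ∈-dots⁺ : ∀ D {x y} xs ys → x ∈ xs → y ∈ ys → D x y ≡ true → (x , y) ∈ dots D xs ys
  ∈-dots⁺ D (x ∷ xs) ys (here refl) y∈ d = ∈-++⁺ˡ (∈-rowDots⁺ D x ys y∈ d)
  ∈-dots⁺ D (x' ∷ xs) ys (there x∈) y∈ d = ∈-++⁺ʳ (rowDots D x' ys) (∈-dots⁺ D xs ys x∈ y∈ d)

  ∈-dots⁻ : ∀ D xs ys {p} → p ∈ dots D xs ys → proj₁ p ∈ xs × D (proj₁ p) (proj₂ p) ≡ true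
  ∈-dots⁻ D (x ∷ xs) ys p∈ with ∈-++⁻ (rowDots D x ys) p∈
  ... | inj₁ p∈ᵣ = let e , d = ∈-rowDots⁻ D x ys p∈ᵣ in here e , d
  ... | inj₂ p∈ₛ = let x∈ , d = ∈-dots⁻ D xs ys p∈ₛ in there x∈ , d

  Unique-rowDots : ∀ D x ys → Unique ys → Unique (rowDots D x ys)
  Unique-rowDots D x []       []          = []
  Unique-rowDots D x (y ∷ ys) (y∉ys ∷ u) with D x y
  ... | true  = All.tabulate (λ p∈ e → All.lookup y∉ys (subst (_∈ ys) (cong proj₂ (sym e)) (proj₂-∈ p∈)) refl)
                ∷ Unique-rowDots D x ys u
    where
    proj₂-∈ : ∀ {ys p} → p ∈ rowDots D x ys → proj₂ p ∈ ys
    proj₂-∈ {y' ∷ ys} p∈ with D x y'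
    proj₂-∈ {y' ∷ ys} (here refl) | true = here refl
    proj₂-∈ {y' ∷ ys} (there p∈)  | true = there (proj₂-∈ p∈)
    proj₂-∈ {y' ∷ ys} p∈          | false = there (proj₂-∈ p∈)
  ... | false = Unique-rowDots D x ys u

  Unique-dots : ∀ D xs ys → Unique xs → Unique ys → Unique (dots D xs ys)
  Unique-dots D []       ys []          uy = []
  Unique-dots D (x ∷ xs) ys (x∉xs ∷ ux) uy = ++⁺ (Unique-rowDots D x ys uy) (Unique-dots D xs ys ux uy)
    λ (p∈ᵣ , p∈ₛ) → All.lookup x∉xs (subst (_∈ xs) (proj₁ (∈-rowDots⁻ D x ys p∈ᵣ)) (proj₁ (∈-dots⁻ D xs ys p∈ₛ))) refl

  dotList : ∀ {m n} → Ferrers m n → List (ℕ × ℕ)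
  dotList {m} {n} F = dots (dot F) (upTo m) (upTo n)

  length-dotList : ∀ {m n} (F : Ferrers m n) → length (dotList F) ≡ size F
  length-dotList {m} {n} F = length-dots (dot F) (upTo m) (upTo n)

  Unique-dotList : ∀ {m n} (F : Ferrers m n) → Unique (dotList F)
  Unique-dotList {m} {n} F = Unique-dots (dot F) (upTo m) (upTo n) (upTo⁺ m) (upTo⁺ n)

  ∈-dotList⁺ : ∀ {m n} (F : Ferrers m n) {x y} → dot F x y ≡ true → (x , y) ∈ dotList F
  ∈-dotList⁺ F {x} {y} d = ∈-dots⁺ (dot F) _ _ (∈-upTo⁺ (proj₁ (inBounds F x y d))) (∈-upTo⁺ (proj₂ (inBounds F x y d))) d

  ∈-dotList⁻ : ∀ {m n} (F : Ferrers m n) {p} → p ∈ dotList F → dot F (proj₁ p) (proj₂ p) ≡ true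
  ∈-dotList⁻ {m} {n} F p∈ = proj₂ (∈-dots⁻ (dot F) (upTo m) (upTo n) p∈)

module MatrixEntries (R : CommutativeRing 0ℓ 0ℓ) where

  open import Data.Nat using (ℕ; _≤_; _≟_; _<?_)
  open import Data.Nat.Properties using (<⇒≱)
  open import Data.Fin using (Fin; toℕ; fromℕ<)
  open import Data.Fin.Properties using (fromℕ<-toℕ; toℕ<n; toℕ-fromℕ<)
  open import Data.Maybe using (Maybe; just; nothing)
  open import Data.Bool using (false)
  open import Data.Product using (_×_; _,_)
  open import Data.Empty using (⊥-elim)
  open import Relation.Nullary using (yes; no)
  import Relation.Binary.PropositionalEquality as ≡
  open ≡ using (_≡_; _≢_)

  open CommutativeRing R hiding (zero) renaming (_+_ to _+R_)
  open Codes R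
  open FinSums R

  δ : ℕ → ℕ → Carrier
  δ u g with u ≟ g
  ... | yes _ = 1#
  ... | no _  = 0#

  δ-refl : ∀ g → δ g g ≈ 1#
  δ-refl g with g ≟ g
  ... | yes _ = refl
  ... | no ne = ⊥-elim (ne ≡.refl)

  atPoint : Maybe (ℕ × ℕ) → ℕ → ℕ → Carrier
  atPoint nothing        g y = 0#
  atPoint (just (u , v)) g y = δ u g * δ v y

  Supported : ∀ {m n} → Ferrers m n → Matrix m n → Set
  Supported F X = ∀ i j → dot F (toℕ i) (toℕ j) ≡ false → X i j ≈ 0#

  atPoint-≢ : ∀ s g y → s ≢ just (g , y) → atPoint s g y ≈ 0#
  atPoint-≢ nothing        g y ne = refl
  atPoint-≢ (just (u , v)) g y ne with u ≟ g | v ≟ y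
  ... | yes ≡.refl | yes ≡.refl = ⊥-elim (ne ≡.refl)
  ... | yes _      | no _       = zeroʳ _
  ... | no _       | _          = zeroˡ _

  atPoint-≡ : ∀ g y → atPoint (just (g , y)) g y ≈ 1#
  atPoint-≡ g y = trans (*-cong (δ-refl g) (δ-refl y)) (*-identityˡ 1#)

  module _ {M N : ℕ} where

    -- Junk value 0# outside the matrix.
    entry : Matrix M N → ℕ → ℕ → Carrier
    entry Y u v with u <? M | v <? N
    ... | yes u<M | yes v<N = Y (fromℕ< u<M) (fromℕ< v<N)
    ... | _       | _       = 0#

    entry-toℕ : ∀ Y g y → entry Y (toℕ g) (toℕ y) ≡ Y g y
    entry-toℕ Y g y with toℕ g <? M | toℕ y <? N
    ... | yes g<M | yes y<N = ≡.cong₂ Y (fromℕ<-toℕ g g<M) (fromℕ<-toℕ y y<N)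
    ... | no g≮M  | _       = ⊥-elim (g≮M (toℕ<n g))
    ... | yes _   | no y≮N  = ⊥-elim (y≮N (toℕ<n y))

    readAt : Maybe (ℕ × ℕ) → Matrix M N → Carrier
    readAt nothing        Y = 0#
    readAt (just (u , v)) Y = entry Y u v

    readAt-lincomb : ∀ {k} s (c : Fin k → Carrier) (Ys : Fin k → Matrix M N) →
                     sumR (λ l → c l * readAt s (Ys l)) ≈ readAt s (lincomb c Ys)
    readAt-lincomb {k} nothing c Ys = sumR-zero {k} (λ l → zeroʳ _)
    readAt-lincomb {k} (just (u , v)) c Ys with u <? M | v <? N
    ... | yes _ | yes _ = refl
    ... | yes _ | no _  = sumR-zero {k} (λ l → zeroʳ _)
    ... | no _  | _     = sumR-zero {k} (λ l → zeroʳ _)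

    readAt-zero : ∀ s Y → IsZero Y → readAt s Y ≈ 0#
    readAt-zero nothing        Y Y≈0 = refl
    readAt-zero (just (u , v)) Y Y≈0 with u <? M | v <? N
    ... | yes _ | yes _ = Y≈0 _ _
    ... | yes _ | no _  = refl
    ... | no _  | _     = refl

    atPoint-readAt : ∀ s Y (g : Fin M) (y : Fin N) →
                     atPoint s (toℕ g) (toℕ y) * readAt s Y ≈ atPoint s (toℕ g) (toℕ y) * Y g y
    atPoint-readAt nothing        Y g y = trans (zeroˡ _) (sym (zeroˡ _))
    atPoint-readAt (just (u , v)) Y g y with u ≟ toℕ g | v ≟ toℕ y
    ... | yes ≡.refl | yes ≡.refl = *-congˡ (reflexive (entry-toℕ Y g y))
    ... | yes _      | no v≢y     = trans (*-congʳ (zeroʳ _)) (trans (zeroˡ _) (sym (trans (*-congʳ (zeroʳ _)) (zeroˡ _))))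
    ... | no u≢g     | _          = trans (*-congʳ (zeroˡ _)) (trans (zeroˡ _) (sym (trans (*-congʳ (zeroˡ _)) (zeroˡ _))))

    entry-lincomb : ∀ {k} (c : Fin k → Carrier) (Ys : Fin k → Matrix M N) u v →
                    sumR (λ l → c l * entry (Ys l) u v) ≈ entry (lincomb c Ys) u v
    entry-lincomb c Ys u v = readAt-lincomb (just (u , v)) c Ys

    entry-belowRows : ∀ Y {u} v → M ≤ u → entry Y u v ≈ 0#
    entry-belowRows Y {u} v M≤u with u <? M
    ... | yes u<M = ⊥-elim (<⇒≱ u<M M≤u)
    ... | no _    = refl

    entry-beyondColumns : ∀ Y u {v} → N ≤ v → entry Y u v ≈ 0#
    entry-beyondColumns Y u {v} N≤v with u <? M | v <? N
    ... | yes _ | yes v<N = ⊥-elim (<⇒≱ v<N N≤v)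
    ... | yes _ | no _    = refl
    ... | no _  | _       = refl

    entry-supported : ∀ {F : Ferrers M N} {Y} → Supported F Y → ∀ u v → dot F u v ≡ false → entry Y u v ≈ 0#
    entry-supported {F} supported u v ¬d with u <? M | v <? N
    ... | yes u<M | yes v<N = supported _ _ (≡.subst₂ (λ u' v' → dot F u' v' ≡ false)
                                (≡.sym (toℕ-fromℕ< u<M)) (≡.sym (toℕ-fromℕ< v<N)) ¬d)
    ... | yes _   | no _    = refl
    ... | no _    | _       = refl

    entry-cong : ∀ {Y Y'} → (∀ i j → Y i j ≈ Y' i j) → ∀ u v → entry Y u v ≈ entry Y' u v
    entry-cong Y≈Y' u v with u <? M | v <? N
    ... | yes _ | yes _ = Y≈Y' _ _
    ... | yes _ | no _  = refl
    ... | no _  | _     = refl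

    entry-zero : ∀ {Y} → IsZero Y → ∀ u v → entry Y u v ≈ 0#
    entry-zero {Y} Y≈0 u v = readAt-zero (just (u , v)) Y Y≈0

module Translation (R : CommutativeRing 0ℓ 0ℓ) where

  open import Data.Nat using (ℕ; _+_; _∸_; _≤_; _<_; _≤ᵇ_)
  open import Data.Nat.Properties using (≤ᵇ⇒≤; ≤⇒≤ᵇ; <⇒≱; m≤m+n; m+n∸m≡n; m+n≤o⇒m≤o∸n; ≤-trans; ≤-reflexive; +-monoʳ-<)
  import Data.Nat.Properties as ℕ
  open import Data.Bool using (Bool; true; false; if_then_else_; _∧_)
  open import Data.Bool.Properties using (T-≡; ¬-not; ∧-zeroʳ)
  open import Data.Fin using (Fin; toℕ; fromℕ<)
  open import Data.Fin.Properties using (toℕ<n; toℕ-fromℕ<)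
  open import Function.Bundles using (Equivalence)
  import Relation.Binary.PropositionalEquality as ≡
  open ≡ using (_≡_)

  open CommutativeRing R hiding (zero) renaming (_+_ to _+R_)
  open Codes R
  open FinSums R
  open MatrixEntries R

  private
    ≤ᵇ-true : ∀ {r x} → r ≤ x → (r ≤ᵇ x) ≡ true
    ≤ᵇ-true r≤x = Equivalence.to T-≡ (≤⇒≤ᵇ r≤x)

    +≤⇒≤∸ : ∀ r {a x} → r + a ≤ x → a ≤ x ∸ r
    +≤⇒≤∸ r {a} r+a≤x = m+n≤o⇒m≤o∸n a (≤-trans (≤-reflexive (ℕ.+-comm a r)) r+a≤x)

    ≤ᵇ-false : ∀ {r x} → x < r → (r ≤ᵇ x) ≡ false
    ≤ᵇ-false {r} {x} x<r = ¬-not (λ e → <⇒≱ x<r (≤ᵇ⇒≤ r x (Equivalence.from T-≡ e)))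

  place : ∀ {a b} → ℕ → ℕ → Matrix a b → ℕ → ℕ → Carrier
  place r c X x y = if (r ≤ᵇ x) ∧ (c ≤ᵇ y) then entry X (x ∸ r) (y ∸ c) else 0#

  module _ {a b : ℕ} where

    place-at : ∀ r c (X : Matrix a b) i j → place r c X (r + toℕ i) (c + toℕ j) ≈ X i j
    place-at r c X i j
      rewrite ≤ᵇ-true (m≤m+n r (toℕ i)) | ≤ᵇ-true (m≤m+n c (toℕ j)) | m+n∸m≡n r (toℕ i) | m+n∸m≡n c (toℕ j)
      = reflexive (entry-toℕ X i j)

    place-above : ∀ r c (X : Matrix a b) {x} y → x < r → place r c X x y ≈ 0#
    place-above r c X y x<r rewrite ≤ᵇ-false x<r = refl

    place-left : ∀ r c (X : Matrix a b) x {y} → y < c → place r c X x y ≈ 0#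
    place-left r c X x y<c rewrite ≤ᵇ-false y<c | ∧-zeroʳ (r ≤ᵇ x) = refl

    place-below : ∀ r c (X : Matrix a b) {x} y → r + a ≤ x → place r c X x y ≈ 0#
    place-below r c X {x} y r+a≤x with (r ≤ᵇ x) ∧ (c ≤ᵇ y)
    ... | true  = entry-belowRows X (y ∸ c) (+≤⇒≤∸ r r+a≤x)
    ... | false = refl

    place-right : ∀ r c (X : Matrix a b) x {y} → c + b ≤ y → place r c X x y ≈ 0#
    place-right r c X x {y} c+b≤y with (r ≤ᵇ x) ∧ (c ≤ᵇ y)
    ... | true  = entry-beyondColumns X (x ∸ r) (+≤⇒≤∸ c c+b≤y)
    ... | false = refl

    place-cong : ∀ r c {X X' : Matrix a b} → (∀ i j → X i j ≈ X' i j) → ∀ x y → place r c X x y ≈ place r c X' x y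
    place-cong r c X≈X' x y with (r ≤ᵇ x) ∧ (c ≤ᵇ y)
    ... | true  = entry-cong X≈X' (x ∸ r) (y ∸ c)
    ... | false = refl

    place-lincomb : ∀ {k} r c (κ : Fin k → Carrier) (Xs : Fin k → Matrix a b) x y →
                    sumR (λ l → κ l * place r c (Xs l) x y) ≈ place r c (lincomb κ Xs) x y
    place-lincomb {k} r c κ Xs x y with (r ≤ᵇ x) ∧ (c ≤ᵇ y)
    ... | true  = entry-lincomb κ Xs (x ∸ r) (y ∸ c)
    ... | false = sumR-zero {k} (λ l → zeroʳ _)

    place-supported : ∀ r c {F : Ferrers a b} {X} → Supported F X →
                      ∀ x y → shift r c (dot F) x y ≡ false → place r c X x y ≈ 0#
    place-supported r c {F} supported x y with (r ≤ᵇ x) ∧ (c ≤ᵇ y)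
    ... | true  = entry-supported {F = F} supported (x ∸ r) (y ∸ c)
    ... | false = λ _ → refl

  shift-at : ∀ r c D x y → shift r c D (r + x) (c + y) ≡ D x y
  shift-at r c D x y rewrite ≤ᵇ-true (m≤m+n r x) | ≤ᵇ-true (m≤m+n c y) | m+n∸m≡n r x | m+n∸m≡n c y = ≡.refl

  place-zero : ∀ {a b} r c {X : Matrix a b} → IsZero X → ∀ x y → place r c X x y ≈ 0#
  place-zero r c X≈0 x y with (r ≤ᵇ x) ∧ (c ≤ᵇ y)
  ... | true  = entry-zero X≈0 (x ∸ r) (y ∸ c)
  ... | false = refl

  offset : ∀ {a k} r → r + a ≤ k → Fin a → Fin k
  offset r r+a≤k i = fromℕ< (≤-trans (+-monoʳ-< r (toℕ<n i)) r+a≤k)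

  toℕ-offset : ∀ {a k} r (r+a≤k : r + a ≤ k) (i : Fin a) → toℕ (offset r r+a≤k i) ≡ r + toℕ i
  toℕ-offset r r+a≤k i = toℕ-fromℕ< _

module PieceEmbedding {q : ℕ} (R : CommutativeRing 0ℓ 0ℓ) (𝔽 : IsFiniteField R q)
  {M N : ℕ} (G : Ferrers M N) {a b : ℕ} (F : Ferrers a b) (φ : Cell F → Cell G)
  (φ-injective : ∀ c c' → proj₁ (φ c) ≡ proj₁ (φ c') → proj₁ c ≡ proj₁ c')
  (φ-lines : ∀ c c' → ¬ proj₁ c ≡ proj₁ c' → SameLine (proj₁ c) (proj₁ c') → SameLine (proj₁ (φ c)) (proj₁ (φ c')))
  where

  open import Data.Nat.Properties using (≤-refl)
  open import Data.Fin using (Fin; toℕ)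
  open import Data.Fin.Properties using (toℕ-injective)
  open import Data.Bool using (Bool; true; false)
  open import Data.Bool.Properties using (not-¬) renaming (_≟_ to _≟ᵇ_)
  open import Axiom.UniquenessOfIdentityProofs using (module Decidable⇒UIP)
  open import Data.Maybe using (Maybe; just; nothing; fromMaybe)
  open import Data.Sum using (inj₁; inj₂)
  open import Data.Product.Properties using (,-injective)
  open import Data.Empty using (⊥-elim)
  import Relation.Binary.PropositionalEquality as ≡
  open ≡ using (_≢_)

  open CommutativeRing R hiding (zero) renaming (_+_ to _+R_)
  open Codes R
  open FinSums R
  open MatrixEntries R
  open RowSpaces R 𝔽
  open LinePreservingMaps
  open import Relation.Binary.Reasoning.Setoid setoid

  position : ∀ x y → dot F x y ≡ true → ℕ × ℕ
  position x y d = proj₁ (φ ((x , y) , d))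

  position-irrelevant : ∀ x y (d d' : dot F x y ≡ true) → position x y d ≡ position x y d'
  position-irrelevant x y d d' = ≡.cong (position x y) (Decidable⇒UIP.≡-irrelevant _≟ᵇ_ d d')

  imageWith : ∀ x y (t : Bool) → dot F x y ≡ t → Maybe (ℕ × ℕ)
  imageWith x y true  d = just (position x y d)
  imageWith x y false _ = nothing

  image : ℕ → ℕ → Maybe (ℕ × ℕ)
  image x y = imageWith x y (dot F x y) ≡.refl

  image-dot : ∀ x y (d : dot F x y ≡ true) → image x y ≡ just (position x y d)
  image-dot x y d = go (dot F x y) ≡.refl
    where
    go : ∀ t (e : dot F x y ≡ t) → imageWith x y t e ≡ just (position x y d)
    go true  e = ≡.cong just (position-irrelevant x y e d)
    go false e = ⊥-elim (not-¬ d e)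

  image-nodot : ∀ x y → dot F x y ≡ false → image x y ≡ nothing
  image-nodot x y ¬d = go (dot F x y) ≡.refl
    where
    go : ∀ t (e : dot F x y ≡ t) → imageWith x y t e ≡ nothing
    go true  e = ⊥-elim (not-¬ e ¬d)
    go false e = ≡.refl

  image-just : ∀ x y {p} → image x y ≡ just p → Σ (dot F x y ≡ true) λ d → position x y d ≡ p
  image-just x y = go (dot F x y) ≡.refl
    where
    go : ∀ t (e : dot F x y ≡ t) {p} → imageWith x y t e ≡ just p → Σ (dot F x y ≡ true) λ d → position x y d ≡ p
    go true e ≡.refl = e , ≡.refl

  -- Junk value (0 , 0) off the cells of F.
  fetch : ℕ → ℕ → ℕ × ℕ
  fetch x y = fromMaybe (0 , 0) (image x y)

  fetch-position : ∀ x y d → fetch x y ≡ position x y d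
  fetch-position x y d = ≡.cong (fromMaybe (0 , 0)) (image-dot x y d)

  lineMap : LinePreserving F fetch
  lineMap = record
    { rowLines  = λ x y y' d d' ne → ≡.subst₂ SameLine (≡.sym (fetch-position x y d)) (≡.sym (fetch-position x y' d'))
                    (φ-lines ((x , y) , d) ((x , y') , d') (λ e → ne (≡.cong proj₂ e)) (inj₁ ≡.refl))
    ; colLines  = λ x x' y d d' ne → ≡.subst₂ SameLine (≡.sym (fetch-position x y d)) (≡.sym (fetch-position x' y d'))
                    (φ-lines ((x , y) , d) ((x' , y) , d') (λ e → ne (≡.cong proj₁ e)) (inj₂ ≡.refl))
    ; injective = λ x y x' y' d d' e → ,-injective (φ-injective ((x , y) , d) ((x' , y') , d')
                    (≡.trans (≡.sym (fetch-position x y d)) (≡.trans e (fetch-position x' y' d'))))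
    }

  image-injective : ∀ x y x' y' {p} → image x y ≡ just p → image x' y' ≡ just p → x ≡ x' × y ≡ y'
  image-injective x y x' y' e e' with image-just x y e | image-just x' y' e'
  ... | d , ≡.refl | d' , p≡ = LinePreserving.injective lineMap x y x' y' d d'
                                 (≡.trans (fetch-position x y d) (≡.trans (≡.sym p≡) (≡.sym (fetch-position x' y' d'))))

  piece : Matrix M N → Matrix a b
  piece Y i j = readAt (image (toℕ i) (toℕ j)) Y

  piece-supported : ∀ Y → Supported F (piece Y)
  piece-supported Y i j ¬d = reflexive (≡.cong (λ s → readAt s Y) (image-nodot _ _ ¬d))

  hit : Fin a → Fin b → Fin M → Fin N → Carrier
  hit i j g y = atPoint (image (toℕ i) (toℕ j)) (toℕ g) (toℕ y)

  embed : Matrix a b → Matrix M N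
  embed X g y = sumR (λ i → sumR (λ j → hit i j g y * X i j))

  cover : Fin M → Fin N → Carrier
  cover g y = sumR (λ i → sumR (λ j → hit i j g y))

  embed-piece : ∀ Y g y → embed (piece Y) g y ≈ cover g y * Y g y
  embed-piece Y g y = begin
    sumR (λ i → sumR (λ j → hit i j g y * piece Y i j))
      ≈⟨ sumR-cong {a} (λ i → sumR-cong {b} (λ j → atPoint-readAt (image (toℕ i) (toℕ j)) Y g y)) ⟩
    sumR (λ i → sumR (λ j → hit i j g y * Y g y))
      ≈⟨ sumR-cong {a} (λ i → *-distribʳ-sumR (Y g y) (λ j → hit i j g y)) ⟨
    sumR (λ i → sumR (λ j → hit i j g y) * Y g y)
      ≈⟨ *-distribʳ-sumR (Y g y) (λ i → sumR (λ j → hit i j g y)) ⟨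
    cover g y * Y g y ∎

  cover-≈0 : ∀ g y → (∀ x y' → image x y' ≢ just (toℕ g , toℕ y)) → cover g y ≈ 0#
  cover-≈0 g y missed = sumR-zero {a} (λ i → sumR-zero {b} (λ j → atPoint-≢ _ _ _ (missed (toℕ i) (toℕ j))))

  cover-≈1 : ∀ g y (i₀ : Fin a) (j₀ : Fin b) → image (toℕ i₀) (toℕ j₀) ≡ just (toℕ g , toℕ y) → cover g y ≈ 1#
  cover-≈1 g y i₀ j₀ hit₀ = begin
    cover g y                                    ≈⟨ sumR-single (λ i → sumR (λ j → hit i j g y)) i₀ other-rows ⟩
    sumR (λ j → hit i₀ j g y)                    ≈⟨ sumR-single (λ j → hit i₀ j g y) j₀ other-columns ⟩
    hit i₀ j₀ g y                                ≡⟨ ≡.cong (λ s → atPoint s (toℕ g) (toℕ y)) hit₀ ⟩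
    atPoint (just (toℕ g , toℕ y)) (toℕ g) (toℕ y) ≈⟨ atPoint-≡ (toℕ g) (toℕ y) ⟩
    1#                                           ∎
    where
    other-rows : ∀ i → i ≢ i₀ → sumR (λ j → hit i j g y) ≈ 0#
    other-rows i i≢i₀ = sumR-zero {b} (λ j → atPoint-≢ _ _ _
      (λ e → i≢i₀ (toℕ-injective (proj₁ (image-injective _ _ _ _ e hit₀)))))
    other-columns : ∀ j → j ≢ j₀ → hit i₀ j g y ≈ 0#
    other-columns j j≢j₀ = atPoint-≢ _ _ _ (λ e → j≢j₀ (toℕ-injective (proj₂ (image-injective _ _ _ _ e hit₀))))

  embed-zero : ∀ X → (∀ i j → X i j ≈ 0#) → ∀ g y → embed X g y ≈ 0#
  embed-zero X X≈0 g y = sumR-zero {a} (λ i → sumR-zero {b} (λ j → trans (*-congˡ (X≈0 i j)) (zeroʳ _)))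

  image-nothing : ∀ x y → image x y ≡ nothing → dot F x y ≡ false
  image-nothing x y = go (dot F x y) ≡.refl
    where
    go : ∀ t (e : dot F x y ≡ t) → imageWith x y t e ≡ nothing → dot F x y ≡ false
    go false e _ = e

  image-cell : ∀ x y {p} → image x y ≡ just p → Σ (Cell F) λ c → proj₁ (φ c) ≡ p
  image-cell x y e with image-just x y e
  ... | d , pos≡p = ((x , y) , d) , pos≡p

  image⇒fetch : ∀ x y {p} → image x y ≡ just p → dot F x y ≡ true × fetch x y ≡ p
  image⇒fetch x y e with image-just x y e
  ... | d , pos≡p = d , ≡.trans (fetch-position x y d) pos≡p

  embed-≈ : ∀ X → Supported F X → ∀ g y (T : Fin a → Fin b → Carrier) →
            (∀ i j {p} → image (toℕ i) (toℕ j) ≡ just p → atPoint (just p) (toℕ g) (toℕ y) ≈ T i j) →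
            embed X g y ≈ sumR (λ i → sumR (λ j → T i j * X i j))
  embed-≈ X supported g y T agrees = sumR-cong {a} (λ i → sumR-cong {b} (λ j → term i j))
    where
    term : ∀ i j → hit i j g y * X i j ≈ T i j * X i j
    term i j with image (toℕ i) (toℕ j) in e
    ... | just p  = *-congʳ (agrees i j e)
    ... | nothing = trans (zeroˡ _) (sym (trans (*-congˡ (supported i j (image-nothing _ _ e))) (zeroʳ _)))

  sumR²-assoc : ∀ (α : Fin a → Carrier) (β X : Fin a → Fin b → Carrier) →
                sumR (λ i → sumR (λ j → (α i * β i j) * X i j)) ≈ sumR (λ i → α i * sumR (λ j → β i j * X i j))
  sumR²-assoc α β X = sumR-cong {a} (λ i → trans (sumR-cong {b} (λ j → *-assoc _ _ _))
                                                  (sym (*-distribˡ-sumR (α i) (λ j → β i j * X i j))))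

  columnδ rowδ : Maybe (ℕ × ℕ) → ℕ → Carrier
  columnδ nothing        y = 0#
  columnδ (just (_ , v)) y = δ v y
  rowδ nothing        g = 0#
  rowδ (just (u , _)) g = δ u g

  module _ (X : Matrix a b) (supported : Supported F X) where
    open Basis (basis X)

    X≈0 : dim ≡ 0 → ∀ i j → X i j ≈ 0#
    X≈0 dim≡0 i = InSpan-empty dim≡0 (spanning i)

    RankAtMost-embed-product : (ρ κ : ℕ → ℕ) → (∀ x y → dot F x y ≡ true → fetch x y ≡ (ρ x , κ y)) →
                               RankAtMost (embed X) dim
    RankAtMost-embed-product ρ κ onCells = dim , ≤-refl , U , λ g → InSpan-resp (λ y → sym (embed≈ g y))
        (span-sumR _ (λ i → span-* _ (span-map K (spanning i))))
      where
      K : Fin b → Fin N → Carrier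
      K j y = δ (κ (toℕ j)) (toℕ y)
      U : Fin dim → Row N
      U t y = sumR (λ j → K j y * X (pick t) j)
      embed≈ : ∀ g y → embed X g y ≈ sumR (λ i → δ (ρ (toℕ i)) (toℕ g) * sumR (λ j → K j y * X i j))
      embed≈ g y = trans (embed-≈ X supported g y (λ i j → δ (ρ (toℕ i)) (toℕ g) * K j y) agrees)
                         (sumR²-assoc _ (λ i j → K j y) X)
        where
        agrees : ∀ i j {p} → image (toℕ i) (toℕ j) ≡ just p → atPoint (just p) (toℕ g) (toℕ y) ≈ δ (ρ (toℕ i)) (toℕ g) * K j y
        agrees i j e with image⇒fetch _ _ e
        ... | d , fetch≡p with ≡.trans (≡.sym fetch≡p) (onCells _ _ d)
        ...   | ≡.refl = refl

    RankAtMost-embed-transposed : (ρ κ : ℕ → ℕ) → (∀ x y → dot F x y ≡ true → fetch x y ≡ (ρ y , κ x)) →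
                                  RankAtMost (embed X) dim
    RankAtMost-embed-transposed ρ κ onCells = dim , ≤-refl , U , λ g → InSpan-resp (λ y → sym (embed≈ g y))
        (span-sumR _ (λ j → span-* _ (span-map K (columns-inSpan X (basis X) j))))
      where
      K : Fin a → Fin N → Carrier
      K i y = δ (κ (toℕ i)) (toℕ y)
      U : Fin dim → Row N
      U t y = sumR (λ i → K i y * proj₁ (spanning i) t)
      embed≈ : ∀ g y → embed X g y ≈ sumR (λ j → δ (ρ (toℕ j)) (toℕ g) * sumR (λ i → K i y * X i j))
      embed≈ g y = begin
        embed X g y ≈⟨ embed-≈ X supported g y (λ i j → δ (ρ (toℕ j)) (toℕ g) * K i y) agrees ⟩
        sumR (λ i → sumR (λ j → (δ (ρ (toℕ j)) (toℕ g) * K i y) * X i j))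
          ≈⟨ sumR-comm (λ i j → (δ (ρ (toℕ j)) (toℕ g) * K i y) * X i j) ⟩
        sumR (λ j → sumR (λ i → (δ (ρ (toℕ j)) (toℕ g) * K i y) * X i j))
          ≈⟨ sumR-cong {b} (λ j → trans (sumR-cong {a} (λ i → *-assoc _ _ _))
                                         (sym (*-distribˡ-sumR _ (λ i → K i y * X i j)))) ⟩
        sumR (λ j → δ (ρ (toℕ j)) (toℕ g) * sumR (λ i → K i y * X i j)) ∎
        where
        agrees : ∀ i j {p} → image (toℕ i) (toℕ j) ≡ just p → atPoint (just p) (toℕ g) (toℕ y) ≈ δ (ρ (toℕ j)) (toℕ g) * K i y
        agrees i j e with image⇒fetch _ _ e
        ... | d , fetch≡p with ≡.trans (≡.sym fetch≡p) (onCells _ _ d)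
        ...   | ≡.refl = refl

    RankAtMost-embed-inOneRow : (r : ℕ) → (∀ x y → dot F x y ≡ true → proj₁ (fetch x y) ≡ r) →
                                RankAtMost (embed X) dim
    RankAtMost-embed-inOneRow r onCells = RankAtMost-outer (embed X) (λ g → δ r (toℕ g)) w dim embed≈
        (λ dim≡0 g y → embed-zero X (X≈0 dim≡0) g y)
      where
      C : Fin a → Fin b → Fin N → Carrier
      C i j y = columnδ (image (toℕ i) (toℕ j)) (toℕ y)
      w : Row N
      w y = sumR (λ i → sumR (λ j → C i j y * X i j))
      embed≈ : ∀ g y → embed X g y ≈ δ r (toℕ g) * w y
      embed≈ g y = begin
        embed X g y ≈⟨ embed-≈ X supported g y (λ i j → δ r (toℕ g) * C i j y) agrees ⟩
        sumR (λ i → sumR (λ j → (δ r (toℕ g) * C i j y) * X i j)) ≈⟨ sumR²-assoc _ (λ i j → C i j y) X ⟩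
        sumR (λ i → δ r (toℕ g) * sumR (λ j → C i j y * X i j))   ≈⟨ *-distribˡ-sumR _ (λ i → sumR (λ j → C i j y * X i j)) ⟨
        δ r (toℕ g) * w y ∎
        where
        agrees : ∀ i j {p} → image (toℕ i) (toℕ j) ≡ just p → atPoint (just p) (toℕ g) (toℕ y) ≈ δ r (toℕ g) * C i j y
        agrees i j {u , v} e with image⇒fetch _ _ e
        ... | d , fetch≡p with ≡.trans (≡.cong proj₁ (≡.sym fetch≡p)) (onCells _ _ d)
        ...   | ≡.refl rewrite e = refl

    RankAtMost-embed-inOneColumn : (c : ℕ) → (∀ x y → dot F x y ≡ true → proj₂ (fetch x y) ≡ c) →
                                   RankAtMost (embed X) dim
    RankAtMost-embed-inOneColumn c onCells = RankAtMost-outer (embed X) u (λ y → δ c (toℕ y)) dim embed≈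
        (λ dim≡0 g y → embed-zero X (X≈0 dim≡0) g y)
      where
      Rw : Fin a → Fin b → Fin M → Carrier
      Rw i j g = rowδ (image (toℕ i) (toℕ j)) (toℕ g)
      u : Row M
      u g = sumR (λ i → sumR (λ j → Rw i j g * X i j))
      embed≈ : ∀ g y → embed X g y ≈ u g * δ c (toℕ y)
      embed≈ g y = begin
        embed X g y ≈⟨ embed-≈ X supported g y (λ i j → δ c (toℕ y) * Rw i j g) agrees ⟩
        sumR (λ i → sumR (λ j → (δ c (toℕ y) * Rw i j g) * X i j)) ≈⟨ sumR²-assoc _ (λ i j → Rw i j g) X ⟩
        sumR (λ i → δ c (toℕ y) * sumR (λ j → Rw i j g * X i j))   ≈⟨ *-distribˡ-sumR _ (λ i → sumR (λ j → Rw i j g * X i j)) ⟨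
        δ c (toℕ y) * u g ≈⟨ *-comm _ _ ⟩
        u g * δ c (toℕ y) ∎
        where
        agrees : ∀ i j {p} → image (toℕ i) (toℕ j) ≡ just p → atPoint (just p) (toℕ g) (toℕ y) ≈ δ c (toℕ y) * Rw i j g
        agrees i j {u , v} e with image⇒fetch _ _ e
        ... | d , fetch≡p with ≡.trans (≡.cong proj₂ (≡.sym fetch≡p)) (onCells _ _ d)
        ...   | ≡.refl rewrite e = *-comm _ _

  RankAtMost-embed : ∀ X → Supported F X → RankAtMost (embed X) (Basis.dim (basis X))
  RankAtMost-embed X supported with shape F lineMap
  ... | product ρ κ onCells    = RankAtMost-embed-product X supported ρ κ onCells
  ... | transposed ρ κ onCells = RankAtMost-embed-transposed X supported ρ κ onCells
  ... | inOneRow r onCells     = RankAtMost-embed-inOneRow X supported r onCells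
  ... | inOneColumn c onCells  = RankAtMost-embed-inOneColumn X supported c onCells

  piece-lincomb : ∀ {k} (c : Fin k → Carrier) (Ys : Fin k → Matrix M N) i j →
                  piece (lincomb c Ys) i j ≈ lincomb c (λ l → piece (Ys l)) i j
  piece-lincomb c Ys i j = sym (readAt-lincomb (image (toℕ i) (toℕ j)) c Ys)

  piece-zero : ∀ {Y} → IsZero Y → IsZero (piece Y)
  piece-zero {Y} Y≈0 i j = readAt-zero (image (toℕ i) (toℕ j)) Y Y≈0

open import Data.Nat using (ℕ; _+_; _∸_; _≤_; _⊓_)
open import Data.Product using (_,_)
open import Data.Vec using (Vec; _∷_; []; lookup)

module ProperCombinationRank {q : ℕ} (R : CommutativeRing 0ℓ 0ℓ) (𝔽 : IsFiniteField R q)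
  {M N s : ℕ} (G : Ferrers M N) (Fs : Vec AnyFerrers s) (PC : ProperCombination G Fs) where

  open import Data.Nat.Properties using (≤-reflexive)
  open import Data.Fin using (Fin; zero; suc; toℕ; fromℕ<)
  open import Data.Fin.Properties using (toℕ-fromℕ<)
  open import Data.Bool using (Bool; true; false)
  open import Data.Maybe using (just)
  open import Data.Product using (Σ; ∃; _×_; _,_; proj₁; proj₂; uncurry)
  open import Data.List using (List; map; length)
  open import Data.List.Properties using (length-map)
  open import Data.List.Membership.Propositional using (_∈_)
  open import Data.List.Membership.Propositional.Properties using (∈-map⁻)
  open import Data.List.Relation.Unary.Unique.Propositional using (Unique)
  import Data.Product.Properties as Product
  import Data.Nat as ℕ
  import Relation.Binary.PropositionalEquality as ≡
  open ≡ using (_≡_; _≢_)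

  open CommutativeRing R hiding (zero) renaming (_+_ to _+R_)
  open Codes R
  open FinSums R
  open MatrixEntries R
  open RowSpaces R 𝔽
  open LinePreservingMaps using (module LinePreserving)
  open Counting
  open ProperCombination PC
  open import Relation.Binary.Reasoning.Setoid setoid

  diagram : (l : Fin s) → Ferrers (proj₁ (lookup Fs l)) (proj₁ (proj₂ (lookup Fs l)))
  diagram l = proj₂ (proj₂ (lookup Fs l))

  module Piece (l : Fin s) = PieceEmbedding R 𝔽 G (diagram l) (φ l) (injective l) (lines l)

  images : Fin s → List (ℕ × ℕ)
  images l = map (uncurry (Piece.fetch l)) (dotList (diagram l))

  private
    _≟²_ = Product.≡-dec ℕ._≟_ ℕ._≟_

    fetch-cell : ∀ l {z} → z ∈ images l → Σ (Cell (diagram l)) λ c → z ≡ proj₁ (φ l c)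
    fetch-cell l z∈ with ∈-map⁻ (uncurry (Piece.fetch l)) z∈
    ... | (x , y) , p∈ , ≡.refl = ((x , y) , d) , Piece.fetch-position l x y d
      where d = ∈-dotList⁻ (diagram l) p∈

    images-unique : Unique (concatFin images)
    images-unique = Unique-concatFin images
      (λ l → Unique-map⁺ _ (λ {p} {p'} p∈ p'∈ e →
               let x≡ , y≡ = LinePreserving.injective (Piece.lineMap l) _ _ _ _
                               (∈-dotList⁻ (diagram l) p∈) (∈-dotList⁻ (diagram l) p'∈) e
               in ≡.cong₂ _,_ x≡ y≡)
             (Unique-dotList (diagram l)))
      (λ l l' l≢l' (z∈ , z∈') → disjoint l l' _ _ l≢l'
         (≡.trans (≡.sym (proj₂ (fetch-cell l z∈))) (proj₂ (fetch-cell l' z∈'))))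

    images⊆dots : ∀ {z} → z ∈ concatFin images → z ∈ dotList G
    images⊆dots z∈ with ∈-concatFin⁻ images z∈
    ... | l , z∈ₗ with fetch-cell l z∈ₗ
    ...   | c , ≡.refl with φ l c
    ...     | _ , d = ∈-dotList⁺ G d

    sumℕ-cong : ∀ {k} {f g : Fin k → ℕ} → (∀ l → f l ≡ g l) → sumℕ f ≡ sumℕ g
    sumℕ-cong {ℕ.zero}  e = ≡.refl
    sumℕ-cong {ℕ.suc k} e = ≡.cong₂ ℕ._+_ (e zero) (sumℕ-cong (λ l → e (suc l)))

    length-images : length (dotList G) ℕ.≤ length (concatFin images)
    length-images = ≤-reflexive (≡.trans (length-dotList G) (≡.trans (≡.sym count)
      (≡.trans (sumℕ-cong (λ l → ≡.sym (≡.trans (length-map _ (dotList (diagram l))) (length-dotList (diagram l)))))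
               (≡.sym (length-concatFin images)))))

  -- Pigeonhole: the disjoint images fill G since their sizes add up to |G|.
  covered : ∀ (g : Fin M) (y : Fin N) → dot G (toℕ g) (toℕ y) ≡ true →
            ∃ λ l → ∃ λ (i : Fin _) → ∃ λ (j : Fin _) → Piece.image l (toℕ i) (toℕ j) ≡ just (toℕ g , toℕ y)
  covered g y d with ∈-concatFin⁻ images
                       (Unique-⊆-length⇒⊇ _≟²_ images-unique images⊆dots length-images (∈-dotList⁺ G d))
  ... | l , gy∈ with ∈-map⁻ (uncurry (Piece.fetch l)) gy∈
  ...   | (x , y') , p∈ , gy≡ = l , fromℕ< x<a , fromℕ< y'<b ,
    ≡.trans (≡.cong₂ (Piece.image l) (toℕ-fromℕ< x<a) (toℕ-fromℕ< y'<b))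
            (≡.trans (Piece.image-dot l x y' dₗ) (≡.cong just (≡.sym (≡.trans gy≡ (Piece.fetch-position l x y' dₗ)))))
    where
    dₗ = ∈-dotList⁻ (diagram l) p∈
    x<a = proj₁ (inBounds (diagram l) x y' dₗ)
    y'<b = proj₂ (inBounds (diagram l) x y' dₗ)

  cover-sum≈1 : ∀ g y → dot G (toℕ g) (toℕ y) ≡ true → sumR (λ l → Piece.cover l g y) ≈ 1#
  cover-sum≈1 g y d =
    let l₀ , i₀ , j₀ , hit₀ = covered g y d
        others : ∀ l → l ≢ l₀ → Piece.cover l g y ≈ 0#
        others l l≢l₀ = Piece.cover-≈0 l g y λ x y' e →
          let c , c↦ = Piece.image-cell l x y' e ; c₀ , c₀↦ = Piece.image-cell l₀ _ _ hit₀
          in disjoint l l₀ c c₀ l≢l₀ (≡.trans c↦ (≡.sym c₀↦))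
    in trans (sumR-single {s} (λ l → Piece.cover l g y) l₀ others) (Piece.cover-≈1 l₀ g y i₀ j₀ hit₀)

  decompose : ∀ Y → Supported G Y → ∀ g y → Y g y ≈ sumR (λ l → Piece.embed l (Piece.piece l Y) g y)
  decompose Y supported g y = begin
    Y g y                                           ≈⟨ Y≈cover*Y ⟩
    sumR (λ l → Piece.cover l g y) * Y g y          ≈⟨ *-distribʳ-sumR (Y g y) (λ l → Piece.cover l g y) ⟩
    sumR (λ l → Piece.cover l g y * Y g y)          ≈⟨ sumR-cong {s} (λ l → Piece.embed-piece l Y g y) ⟨
    sumR (λ l → Piece.embed l (Piece.piece l Y) g y) ∎
    where
    Y≈cover*Y : Y g y ≈ sumR (λ l → Piece.cover l g y) * Y g y
    Y≈cover*Y with dot G (toℕ g) (toℕ y) in d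
    ... | true  = sym (trans (*-congʳ (cover-sum≈1 g y d)) (*-identityˡ _))
    ... | false = trans (supported g y d) (sym (trans (*-congˡ (supported g y d)) (zeroʳ _)))

  RankAtMost-pieces : ∀ Y → Supported G Y → RankAtMost Y (sumℕ (λ l → Basis.dim (basis (Piece.piece l Y))))
  RankAtMost-pieces Y supported = RankAtMost-resp (λ g y → sym (decompose Y supported g y))
    (RankAtMost-sumR (λ l → Piece.embed l (Piece.piece l Y)) _
      (λ l → Piece.RankAtMost-embed l (Piece.piece l Y) (Piece.piece-supported l Y)))

  pieces≈0⇒≈0 : ∀ Y → Supported G Y → (∀ l i j → Piece.piece l Y i j ≈ 0#) → ∀ g y → Y g y ≈ 0#
  pieces≈0⇒≈0 Y supported pieces≈0 g y = trans (decompose Y supported g y)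
    (sumR-zero {s} (λ l → Piece.embed-zero l (Piece.piece l Y) (pieces≈0 l) g y))

module Layout {q : ℕ} (R : CommutativeRing 0ℓ 0ℓ) (𝔽 : IsFiniteField R q)
  (m₁ n₁ m₂ n₂ m₃ n₃ m₄ n₄ : ℕ)
  (F₁ : Ferrers m₁ n₁) (F₂ : Ferrers m₂ n₂) (F₃ : Ferrers m₃ n₃) (F₄ : Ferrers m₄ n₄)
  (m₁₂≤m₄ : m₁ + m₂ ≤ m₄) (n₂₃≤n₄ : n₂ + n₃ ≤ n₄)
  (F : Ferrers (m₃ + m₄) (n₁ + n₄))
  (F-union : DisjointUnion (dot F)
    (dot F₁ ∷ shift m₁ n₁ (dot F₂) ∷ shift 0 n₁ (dot F₄) ∷ shift m₄ ((n₁ + n₄) ∸ n₃) (dot F₃) ∷ []))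
  {M N : ℕ} (G : Ferrers M N)
  (PC : ProperCombination G ((m₁ , n₁ , F₁) ∷ (m₂ , n₂ , F₂) ∷ (m₃ , n₃ , F₃) ∷ []))
  where

  open import Data.Nat using (suc; _<_; z≤n; >-nonZero)
  open import Data.Nat.Properties
    using (≤-trans; ≤-reflexive; <-≤-trans; m≤m+n; m≤n+m; m∸n+n≡m; m+n≤o⇒m≤o∸n; ≤-pred; m⊓n≤m; m⊓n≤n)
  import Data.Nat.Properties as ℕ
  open import Data.Fin using (Fin; zero; suc; toℕ; _↑ˡ_; _↑ʳ_)
  open import Data.Fin.Properties using (toℕ<n)
  open import Data.Bool using (true; false)
  open import Data.Bool.Properties using (¬-not; not-¬)
  open import Data.Product using (proj₁; proj₂)
  open import Data.Empty using (⊥-elim)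
  open import Relation.Nullary using (¬_; yes; no)
  open import Data.Vec.Functional using (_++_)
  open import Data.Vec.Functional.Properties using (lookup-++ˡ; lookup-++ʳ)
  import Relation.Binary.PropositionalEquality as ≡
  open ≡ using (_≡_; _≢_)

  open CommutativeRing R hiding (zero) renaming (_+_ to _+R_)
  open Codes R
  open MatrixEntries R
  open Translation R
  open RowSpaces R 𝔽
  open FinSums R
  open ProperCombinationRank R 𝔽 G _ PC
  open import Relation.Binary.Reasoning.Setoid setoid

  m n c₃ : ℕ
  m  = m₃ + m₄
  n  = n₁ + n₄
  c₃ = n ∸ n₃

  m₁≤m₄ : m₁ ≤ m₄
  m₁≤m₄ = ≤-trans (m≤m+n m₁ m₂) m₁₂≤m₄

  m₄≤m : m₄ ≤ m
  m₄≤m = m≤n+m m₄ m₃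

  n₂≤n₄ : n₂ ≤ n₄
  n₂≤n₄ = ≤-trans (m≤m+n n₂ n₃) n₂₃≤n₄

  n₃≤n : n₃ ≤ n
  n₃≤n = ≤-trans (≤-trans (m≤n+m n₃ n₂) n₂₃≤n₄) (m≤n+m n₄ n₁)

  n₁₂≤c₃ : n₁ + n₂ ≤ c₃
  n₁₂≤c₃ = m+n≤o⇒m≤o∸n (n₁ + n₂) (≤-trans (≤-reflexive (ℕ.+-assoc n₁ n₂ n₃)) (ℕ.+-monoʳ-≤ n₁ n₂₃≤n₄))

  n₁≤c₃ : n₁ ≤ c₃
  n₁≤c₃ = ≤-trans (m≤m+n n₁ n₂) n₁₂≤c₃

  m₁+<m₄ : ∀ {i} → i < m₂ → m₁ + i < m₄
  m₁+<m₄ i<m₂ = <-≤-trans (ℕ.+-monoʳ-< m₁ i<m₂) m₁₂≤m₄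

  dot-rightward : ∀ {a b} (D : Ferrers a b) {x y y'} → dot D x y ≡ true → y ≤ y' → y' < b → dot D x y' ≡ true
  dot-rightward D {y' = ℕ.zero} d z≤n _ = d
  dot-rightward D {x} {y} {suc k} d y≤k+1 k+1<b with y ℕ.≟ suc k
  ... | yes ≡.refl = d
  ... | no y≢k+1  = rightClosed D x k k+1<b
                        (dot-rightward D d (≤-pred (ℕ.≤∧≢⇒< y≤k+1 y≢k+1)) (ℕ.<-trans (ℕ.n<1+n k) k+1<b))

  -- The dots of F₄ avoid the rows and first columns used by F₂: a dot there would, by right
  -- closedness of F₄, reach the last column of F₂, where both pieces would then put a dot of F.
  F₄-hole : ∀ {i j} → i < m₂ → j < n₂ → dot F₄ (m₁ + i) j ≡ false
  F₄-hole {i} {j} i<m₂ j<n₂ = ¬-not λ d → second≢third (proj₂ (proj₂ (F-union (m₁ + i) (n₁ + j'))) (suc zero) (suc (suc zero))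
      (≡.trans (shift-at m₁ n₁ (dot F₂) i j') (proj₂ (lastCol F₂) i i<m₂))
      (≡.trans (shift-at 0 n₁ (dot F₄) (m₁ + i) j') (dot-rightward F₄ d j≤j' j'<n₄)))
    where
    j' = n₂ ∸ 1
    j≤j' : j ≤ j'
    j≤j' = ℕ.<⇒≤pred j<n₂
    j'<n₄ : j' < n₄
    j'<n₄ = <-≤-trans (≤-reflexive (ℕ.suc-pred n₂ {{>-nonZero (ℕ.≤-<-trans z≤n j<n₂)}})) n₂≤n₄
    second≢third : suc {3} zero ≢ suc (suc zero)
    second≢third ()

  X₁ : Matrix M N → Matrix m₁ n₁
  X₁ = Piece.piece zero
  X₂ : Matrix M N → Matrix m₂ n₂
  X₂ = Piece.piece (suc zero)
  X₃ : Matrix M N → Matrix m₃ n₃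
  X₃ = Piece.piece (suc (suc zero))

  Φ : Matrix M N → ℕ → ℕ → Carrier
  Φ Y x y = place 0 0 (X₁ Y) x y +R (place m₁ n₁ (X₂ Y) x y +R place m₄ c₃ (X₃ Y) x y)

  Ψ : Matrix m₄ n₄ → ℕ → ℕ → Carrier
  Ψ Z = place 0 n₁ Z

  E : Matrix M N → Matrix m₄ n₄ → ℕ → ℕ → Carrier
  E Y Z x y = Φ Y x y +R Ψ Z x y

  layout : Matrix M N → Matrix m₄ n₄ → Matrix m n
  layout Y Z i j = E Y Z (toℕ i) (toℕ j)

  private
    ≈+0 : ∀ {a b x} → a ≈ x → b ≈ 0# → a +R b ≈ x
    ≈+0 a≈x b≈0 = trans (+-cong a≈x b≈0) (+-identityʳ _)

    0+≈ : ∀ {a b x} → a ≈ 0# → b ≈ x → a +R b ≈ x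
    0+≈ a≈0 b≈x = trans (+-cong a≈0 b≈x) (+-identityˡ _)

  Φ-zero : ∀ {Y} → IsZero Y → ∀ x y → Φ Y x y ≈ 0#
  Φ-zero Y≈0 x y = 0+≈ (place-zero 0 0 (Piece.piece-zero zero Y≈0) x y)
                       (0+≈ (place-zero m₁ n₁ (Piece.piece-zero (suc zero) Y≈0) x y)
                            (place-zero m₄ c₃ (Piece.piece-zero (suc (suc zero)) Y≈0) x y))

  module _ (Y : Matrix M N) (Z : Matrix m₄ n₄) where

    E-11 : ∀ i j → E Y Z (toℕ i) (toℕ j) ≈ X₁ Y i j
    E-11 i j = ≈+0 (≈+0 (place-at 0 0 (X₁ Y) i j)
                        (0+≈ (place-above m₁ n₁ (X₂ Y) _ (toℕ<n i))
                             (place-above m₄ c₃ (X₃ Y) _ (<-≤-trans (toℕ<n i) m₁≤m₄))))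
                   (place-left 0 n₁ Z _ (toℕ<n j))

    E-21 : ∀ (i : Fin m₂) (j : Fin n₁) → E Y Z (m₁ + toℕ i) (toℕ j) ≈ 0#
    E-21 i j = 0+≈ (0+≈ (place-below 0 0 (X₁ Y) _ (m≤m+n m₁ (toℕ i)))
                        (0+≈ (place-left m₁ n₁ (X₂ Y) _ (toℕ<n j))
                             (place-above m₄ c₃ (X₃ Y) _ (m₁+<m₄ (toℕ<n i)))))
                   (place-left 0 n₁ Z _ (toℕ<n j))

    E-31 : ∀ (i : Fin m₃) (j : Fin n₁) → E Y Z (m₄ + toℕ i) (toℕ j) ≈ 0#
    E-31 i j = 0+≈ (0+≈ (place-below 0 0 (X₁ Y) _ (≤-trans m₁≤m₄ (m≤m+n m₄ (toℕ i))))
                        (0+≈ (place-below m₁ n₁ (X₂ Y) _ (≤-trans m₁₂≤m₄ (m≤m+n m₄ (toℕ i))))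
                             (place-left m₄ c₃ (X₃ Y) _ (<-≤-trans (toℕ<n j) n₁≤c₃))))
                   (place-left 0 n₁ Z _ (toℕ<n j))

    E-22 : Supported F₄ Z → ∀ i j → E Y Z (m₁ + toℕ i) (n₁ + toℕ j) ≈ X₂ Y i j
    E-22 Z-supported i j = ≈+0 (0+≈ (place-right 0 0 (X₁ Y) _ (m≤m+n n₁ (toℕ j)))
                                    (≈+0 (place-at m₁ n₁ (X₂ Y) i j)
                                         (place-above m₄ c₃ (X₃ Y) _ (m₁+<m₄ (toℕ<n i)))))
                               (place-supported 0 n₁ {F₄} Z-supported (m₁ + toℕ i) (n₁ + toℕ j)
                                 (≡.trans (shift-at 0 n₁ (dot F₄) (m₁ + toℕ i) (toℕ j)) (F₄-hole (toℕ<n i) (toℕ<n j))))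

    E-32 : ∀ (i : Fin m₃) (j : Fin n₂) → E Y Z (m₄ + toℕ i) (n₁ + toℕ j) ≈ 0#
    E-32 i j = 0+≈ (0+≈ (place-right 0 0 (X₁ Y) _ (m≤m+n n₁ (toℕ j)))
                        (0+≈ (place-below m₁ n₁ (X₂ Y) _ (≤-trans m₁₂≤m₄ (m≤m+n m₄ (toℕ i))))
                             (place-left m₄ c₃ (X₃ Y) _ (<-≤-trans (ℕ.+-monoʳ-< n₁ (toℕ<n j)) n₁₂≤c₃))))
                   (place-below 0 n₁ Z _ (m≤m+n m₄ (toℕ i)))

    E-33 : ∀ i j → E Y Z (m₄ + toℕ i) (c₃ + toℕ j) ≈ X₃ Y i j
    E-33 i j = ≈+0 (0+≈ (place-below 0 0 (X₁ Y) _ (≤-trans m₁≤m₄ (m≤m+n m₄ (toℕ i))))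
                        (0+≈ (place-below m₁ n₁ (X₂ Y) _ (≤-trans m₁₂≤m₄ (m≤m+n m₄ (toℕ i))))
                             (place-at m₄ c₃ (X₃ Y) i j)))
                   (place-below 0 n₁ Z _ (m≤m+n m₄ (toℕ i)))

    E-44 : IsZero Y → ∀ i j → E Y Z (toℕ i) (n₁ + toℕ j) ≈ Z i j
    E-44 Y≈0 i j = 0+≈ (Φ-zero Y≈0 _ _) (place-at 0 n₁ Z i j)

  ρ₁ : Fin m₁ → Fin m
  ρ₁ = offset 0 (≤-trans m₁≤m₄ m₄≤m)
  ρ₂ : Fin m₂ → Fin m
  ρ₂ = offset m₁ (≤-trans m₁₂≤m₄ m₄≤m)
  ρ₃ : Fin m₃ → Fin m
  ρ₃ = offset m₄ (≤-reflexive (ℕ.+-comm m₄ m₃))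
  ρ₄ : Fin m₄ → Fin m
  ρ₄ = offset 0 m₄≤m
  κ₁ : Fin n₁ → Fin n
  κ₁ = offset 0 (m≤m+n n₁ n₄)
  κ₂ : Fin n₂ → Fin n
  κ₂ = offset n₁ (ℕ.+-monoʳ-≤ n₁ n₂≤n₄)
  κ₃ : Fin n₃ → Fin n
  κ₃ = offset c₃ (≤-reflexive (m∸n+n≡m n₃≤n))
  κ₄ : Fin n₄ → Fin n
  κ₄ = offset n₁ ℕ.≤-refl

  toℕ-ρ₁ : ∀ i → toℕ (ρ₁ i) ≡ toℕ i
  toℕ-ρ₁ = toℕ-offset 0 (≤-trans m₁≤m₄ m₄≤m)
  toℕ-ρ₂ : ∀ i → toℕ (ρ₂ i) ≡ m₁ + toℕ i
  toℕ-ρ₂ = toℕ-offset m₁ (≤-trans m₁₂≤m₄ m₄≤m)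
  toℕ-ρ₃ : ∀ i → toℕ (ρ₃ i) ≡ m₄ + toℕ i
  toℕ-ρ₃ = toℕ-offset m₄ (≤-reflexive (ℕ.+-comm m₄ m₃))
  toℕ-ρ₄ : ∀ i → toℕ (ρ₄ i) ≡ toℕ i
  toℕ-ρ₄ = toℕ-offset 0 m₄≤m
  toℕ-κ₁ : ∀ j → toℕ (κ₁ j) ≡ toℕ j
  toℕ-κ₁ = toℕ-offset 0 (m≤m+n n₁ n₄)
  toℕ-κ₂ : ∀ j → toℕ (κ₂ j) ≡ n₁ + toℕ j
  toℕ-κ₂ = toℕ-offset n₁ (ℕ.+-monoʳ-≤ n₁ n₂≤n₄)
  toℕ-κ₃ : ∀ j → toℕ (κ₃ j) ≡ c₃ + toℕ j
  toℕ-κ₃ = toℕ-offset c₃ (≤-reflexive (m∸n+n≡m n₃≤n))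
  toℕ-κ₄ : ∀ j → toℕ (κ₄ j) ≡ n₁ + toℕ j
  toℕ-κ₄ = toℕ-offset n₁ ℕ.≤-refl

  layout-at : ∀ Y Z {i j x y} → toℕ i ≡ x → toℕ j ≡ y → layout Y Z i j ≈ E Y Z x y
  layout-at Y Z ≡.refl ≡.refl = refl

  -- The layout is block lower triangular with the three pieces on the diagonal.
  layout-RankAtLeast : ∀ Y Z → Supported F₄ Z →
    RankAtLeast (layout Y Z) (Basis.dim (basis (X₁ Y)) + (Basis.dim (basis (X₂ Y)) + Basis.dim (basis (X₃ Y))))
  layout-RankAtLeast Y Z Z-supported = rows₁ ++ (rows₂ ++ rows₃) ,
    Independent-rows-++ L κ₁ rows₁ (rows₂ ++ rows₃) independent₁
      (∀-++ {P = λ row → ∀ j → L row (κ₁ j) ≈ 0#} rows₂ rows₃ (λ t j → trans (layout-at Y Z (toℕ-ρ₂ (B₂.pick t)) (toℕ-κ₁ j)) (E-21 Y Z (B₂.pick t) j))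
                        (λ t j → trans (layout-at Y Z (toℕ-ρ₃ (B₃.pick t)) (toℕ-κ₁ j)) (E-31 Y Z (B₃.pick t) j)))
      (Independent-rows-++ L κ₂ rows₂ rows₃ independent₂
        (λ t j → trans (layout-at Y Z (toℕ-ρ₃ (B₃.pick t)) (toℕ-κ₂ j)) (E-32 Y Z (B₃.pick t) j)) independent₃)
    where
    L = layout Y Z
    module B₁ = Basis (basis (X₁ Y))
    module B₂ = Basis (basis (X₂ Y))
    module B₃ = Basis (basis (X₃ Y))
    rows₁ = λ t → ρ₁ (B₁.pick t)
    rows₂ = λ t → ρ₂ (B₂.pick t)
    rows₃ = λ t → ρ₃ (B₃.pick t)
    independent₁ : Independent (λ t j → L (rows₁ t) (κ₁ j))
    independent₁ = Independent-resp (λ t j → sym (trans (layout-at Y Z (toℕ-ρ₁ (B₁.pick t)) (toℕ-κ₁ j)) (E-11 Y Z (B₁.pick t) j)))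
                     B₁.independent
    independent₂ : Independent (λ t j → L (rows₂ t) (κ₂ j))
    independent₂ = Independent-resp (λ t j → sym (trans (layout-at Y Z (toℕ-ρ₂ (B₂.pick t)) (toℕ-κ₂ j)) (E-22 Y Z Z-supported (B₂.pick t) j)))
                     B₂.independent
    independent₃ : Independent (λ t → L (rows₃ t))
    independent₃ = Independent-fromColumns κ₃
      (Independent-resp (λ t j → sym (trans (layout-at Y Z (toℕ-ρ₃ (B₃.pick t)) (toℕ-κ₃ j)) (E-33 Y Z (B₃.pick t) j))) B₃.independent)

  Φ-lincomb : ∀ {k} (κ : Fin k → Carrier) (Ys : Fin k → Matrix M N) x y →
              sumR (λ l → κ l * Φ (Ys l) x y) ≈ Φ (lincomb κ Ys) x y
  Φ-lincomb {k} κ Ys x y = begin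
    sumR (λ l → κ l * (P₁ l +R (P₂ l +R P₃ l)))
      ≈⟨ sumR-cong {k} (λ l → trans (distribˡ _ _ _) (+-congˡ (distribˡ _ _ _))) ⟩
    sumR (λ l → κ l * P₁ l +R (κ l * P₂ l +R κ l * P₃ l))
      ≈⟨ trans (sumR-distrib-+ (λ l → κ l * P₁ l) _) (+-congˡ (sumR-distrib-+ (λ l → κ l * P₂ l) _)) ⟩
    sumR (λ l → κ l * P₁ l) +R (sumR (λ l → κ l * P₂ l) +R sumR (λ l → κ l * P₃ l))
      ≈⟨ +-cong (piece-term zero 0 0) (+-cong (piece-term (suc zero) m₁ n₁) (piece-term (suc (suc zero)) m₄ c₃)) ⟩
    Φ (lincomb κ Ys) x y ∎
    where
    P₁ P₂ P₃ : Fin k → Carrier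
    P₁ l = place 0 0 (X₁ (Ys l)) x y
    P₂ l = place m₁ n₁ (X₂ (Ys l)) x y
    P₃ l = place m₄ c₃ (X₃ (Ys l)) x y
    piece-term : ∀ p r c → sumR (λ l → κ l * place r c (Piece.piece p (Ys l)) x y) ≈ place r c (Piece.piece p (lincomb κ Ys)) x y
    piece-term p r c = trans (place-lincomb r c κ (λ l → Piece.piece p (Ys l)) x y)
                             (place-cong r c (λ i j → sym (Piece.piece-lincomb p κ Ys i j)) x y)

  Φ-supported : ∀ Y x y → dot F x y ≡ false → Φ Y x y ≈ 0#
  Φ-supported Y x y ¬d = 0+≈ (place-supported 0 0 {F₁} (Piece.piece-supported zero Y) x y (outside zero))
                            (0+≈ (place-supported m₁ n₁ {F₂} (Piece.piece-supported (suc zero) Y) x y (outside (suc zero)))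
                                 (place-supported m₄ c₃ {F₃} (Piece.piece-supported (suc (suc zero)) Y) x y (outside (suc (suc (suc zero))))))
    where
    outside : ∀ l → lookup (dot F₁ ∷ shift m₁ n₁ (dot F₂) ∷ shift 0 n₁ (dot F₄) ∷ shift m₄ c₃ (dot F₃) ∷ []) l x y ≡ false
    outside l = ¬-not λ inside → not-¬ (proj₁ (proj₂ (F-union x y)) l inside) ¬d

  module _ {k₁ δ₁ k₄ δ₄ : ℕ} (C₁ : Code G k₁ δ₁) (C₄ : Code F₄ k₄ δ₄) where
    private
      module C₁ = Code C₁
      module C₄ = Code C₄

    Φ-basis : Fin k₁ → Matrix m n
    Φ-basis l i j = Φ (C₁.basis l) (toℕ i) (toℕ j)

    Ψ-basis : Fin k₄ → Matrix m n
    Ψ-basis l i j = Ψ (C₄.basis l) (toℕ i) (toℕ j)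

    codeBasis : Fin (k₁ + k₄) → Matrix m n
    codeBasis = Φ-basis ++ Ψ-basis

    Y[_] : (Fin (k₁ + k₄) → Carrier) → Matrix M N
    Y[ c ] = lincomb (λ l → c (l ↑ˡ k₄)) C₁.basis

    Z[_] : (Fin (k₁ + k₄) → Carrier) → Matrix m₄ n₄
    Z[ c ] = lincomb (λ l → c (k₁ ↑ʳ l)) C₄.basis

    Y-supported : ∀ c → Supported G Y[ c ]
    Y-supported c g y ¬d = sumR-zero {k₁} (λ l → trans (*-congˡ (C₁.supported l g y ¬d)) (zeroʳ _))

    Z-supported : ∀ c → Supported F₄ Z[ c ]
    Z-supported c i j ¬d = sumR-zero {k₄} (λ l → trans (*-congˡ (C₄.supported l i j ¬d)) (zeroʳ _))

    codeBasis-lincomb : ∀ c i j → lincomb c codeBasis i j ≈ layout Y[ c ] Z[ c ] i j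
    codeBasis-lincomb c i j = trans (sumR-split {k₁} {k₄} (λ l → c l * codeBasis l i j)) (+-cong
      (trans (sumR-cong {k₁} (λ l → *-congˡ (reflexive (≡.cong (λ B → B i j) (lookup-++ˡ Φ-basis Ψ-basis l)))))
             (Φ-lincomb (λ l → c (l ↑ˡ k₄)) C₁.basis (toℕ i) (toℕ j)))
      (trans (sumR-cong {k₄} (λ l → *-congˡ (reflexive (≡.cong (λ B → B i j) (lookup-++ʳ Φ-basis Ψ-basis l)))))
             (place-lincomb 0 n₁ (λ l → c (k₁ ↑ʳ l)) C₄.basis (toℕ i) (toℕ j))))

    codeBasis-supported : ∀ l i j → dot F (toℕ i) (toℕ j) ≡ false → codeBasis l i j ≈ 0#
    codeBasis-supported l i j ¬d = ∀-++ {P = λ B → B i j ≈ 0#} Φ-basis Ψ-basis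
      (λ l → Φ-supported (C₁.basis l) (toℕ i) (toℕ j) ¬d)
      (λ l → place-supported 0 n₁ {F₄} (C₄.supported l) (toℕ i) (toℕ j)
               (¬-not λ inside → not-¬ (proj₁ (proj₂ (F-union (toℕ i) (toℕ j))) (suc (suc zero)) inside) ¬d))
      l

    -- The pieces of Y[ c ] sit on the diagonal blocks, so they vanish with the combination; then
    -- Z[ c ] is read off from the block of F₄.
    codeBasis-independent : ∀ c → IsZero (lincomb c codeBasis) → ∀ l → c l ≈ 0#
    codeBasis-independent c combination≈0 = ∀-↑ {k₁} {k₄} {λ l → c l ≈ 0#} (C₁.independent _ Y≈0) (C₄.independent _ Z≈0)
      where
      L≈0 : ∀ {x y} (i : Fin m) (j : Fin n) → toℕ i ≡ x → toℕ j ≡ y → E Y[ c ] Z[ c ] x y ≈ 0#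
      L≈0 i j ≡.refl ≡.refl = trans (sym (codeBasis-lincomb c i j)) (combination≈0 i j)
      Y≈0 : IsZero Y[ c ]
      Y≈0 = pieces≈0⇒≈0 Y[ c ] (Y-supported c) λ
        { zero                → λ i j → trans (sym (E-11 Y[ c ] Z[ c ] i j)) (L≈0 (ρ₁ i) (κ₁ j) (toℕ-ρ₁ i) (toℕ-κ₁ j))
        ; (suc zero)          → λ i j → trans (sym (E-22 Y[ c ] Z[ c ] (Z-supported c) i j)) (L≈0 (ρ₂ i) (κ₂ j) (toℕ-ρ₂ i) (toℕ-κ₂ j))
        ; (suc (suc zero))    → λ i j → trans (sym (E-33 Y[ c ] Z[ c ] i j)) (L≈0 (ρ₃ i) (κ₃ j) (toℕ-ρ₃ i) (toℕ-κ₃ j))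
        }
      Z≈0 : IsZero Z[ c ]
      Z≈0 i j = trans (sym (E-44 Y[ c ] Z[ c ] Y≈0 i j)) (L≈0 (ρ₄ i) (κ₄ j) (toℕ-ρ₄ i) (toℕ-κ₄ j))

    -- If Y[ c ] ≠ 0, its rank is at most the sum of the ranks of its pieces, which the layout
    -- attains; otherwise the rank of Z[ c ] is visible on the block of F₄.
    codeBasis-minRank : ∀ c → ¬ IsZero (lincomb c codeBasis) → RankAtLeast (lincomb c codeBasis) (δ₁ ⊓ δ₄)
    codeBasis-minRank c nonzero with IsZero? Y[ c ]
    ... | no Y≉0 = RankAtLeast-resp {M = layout Y[ c ] Z[ c ]} (λ i j → sym (codeBasis-lincomb c i j))
          (RankAtLeast-≤ (layout Y[ c ] Z[ c ]) (≤-trans (m⊓n≤m δ₁ δ₄) δ₁≤pieces) (layout-RankAtLeast Y[ c ] Z[ c ] (Z-supported c)))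
      where
      d₁ d₂ d₃ : ℕ
      d₁ = Basis.dim (basis (X₁ Y[ c ]))
      d₂ = Basis.dim (basis (X₂ Y[ c ]))
      d₃ = Basis.dim (basis (X₃ Y[ c ]))
      δ₁≤pieces : δ₁ ≤ d₁ + (d₂ + d₃)
      δ₁≤pieces = ≤-trans (RankAtLeast⇒≤RankAtMost (C₁.minRank _ Y≉0) (RankAtMost-pieces Y[ c ] (Y-supported c)))
                          (≤-reflexive (≡.cong (d₁ +_) (≡.cong (d₂ +_) (ℕ.+-identityʳ d₃))))
    ... | yes Y≈0 with IsZero? Z[ c ]
    ...   | yes Z≈0 = ⊥-elim (nonzero λ i j → trans (codeBasis-lincomb c i j)
                        (0+≈ (Φ-zero Y≈0 (toℕ i) (toℕ j)) (place-zero 0 n₁ Z≈0 (toℕ i) (toℕ j))))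
    ...   | no Z≉0 with C₄.minRank _ Z≉0
    ...     | pick , independent = RankAtLeast-resp {M = layout Y[ c ] Z[ c ]} (λ i j → sym (codeBasis-lincomb c i j))
                (RankAtLeast-≤ (layout Y[ c ] Z[ c ]) (m⊓n≤n δ₁ δ₄) ((λ t → ρ₄ (pick t)) , Independent-fromColumns κ₄
                  (Independent-resp (λ t j → sym (trans (layout-at Y[ c ] Z[ c ] (toℕ-ρ₄ (pick t)) (toℕ-κ₄ j))
                                                        (E-44 Y[ c ] Z[ c ] Y≈0 (pick t) j)))
                                    independent)))

mainTheorem6 : (q : ℕ) → IsPrimePower q →
    (R : CommutativeRing 0ℓ 0ℓ) → IsFiniteField R q →
    (m₁ n₁ m₂ n₂ m₃ n₃ m₄ n₄ : ℕ) →
    (F₁ : Ferrers m₁ n₁) (F₂ : Ferrers m₂ n₂) (F₃ : Ferrers m₃ n₃) (F₄ : Ferrers m₄ n₄) →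
    m₁ + m₂ ≤ m₄ → n₂ + n₃ ≤ n₄ →
    (F : Ferrers (m₃ + m₄) (n₁ + n₄)) →
    DisjointUnion (dot F)
      (dot F₁ ∷ shift m₁ n₁ (dot F₂) ∷ shift 0 n₁ (dot F₄)
        ∷ shift m₄ ((n₁ + n₄) ∸ n₃) (dot F₃) ∷ []) →
    (m₁₂₃ n₁₂₃ : ℕ) (F₁₂₃ : Ferrers m₁₂₃ n₁₂₃) →
    ProperCombination F₁₂₃ ((m₁ , n₁ , F₁) ∷ (m₂ , n₂ , F₂) ∷ (m₃ , n₃ , F₃) ∷ []) →
    (k₁ δ₁ k₄ δ₄ : ℕ) →
    Codes.Code R F₁₂₃ k₁ δ₁ → Codes.Code R F₄ k₄ δ₄ →
    Codes.Code R F (k₁ + k₄) (δ₁ ⊓ δ₄)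
mainTheorem6 _ _ R 𝔽 m₁ n₁ m₂ n₂ m₃ n₃ m₄ n₄ F₁ F₂ F₃ F₄ m₁₂≤m₄ n₂₃≤n₄ F F-union _ _ G PC _ _ _ _ C₁ C₄ = record
  { basis       = codeBasis C₁ C₄
  ; independent = codeBasis-independent C₁ C₄
  ; supported   = codeBasis-supported C₁ C₄
  ; minRank     = codeBasis-minRank C₁ C₄
  }
  where open Layout R 𝔽 m₁ n₁ m₂ n₂ m₃ n₃ m₄ n₄ F₁ F₂ F₃ F₄ m₁₂≤m₄ n₂₃≤n₄ F F-union G PC
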